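{- For $n\ge 3$ and $2\le m\le n-1$, $$B_{n,m}(u,v)=vB_{n-1,m}(u,v)+\frac{v}{1-u}\bigl(uB_{n-1,m-1}(1,v)-B_{n-1,m-1}(u,v)\bigr)+v\sum_{j=0}^{n-m-1}u^jB_{n-j-1,m-1}(u,1),$$ and $$B_{n,1}(u,v)=\frac{uv(u^{n-1}-v^{n-1})}{u-v}.$$
   Context: An ascent in a sequence $x_1\cdots x_k$ is an index $j$ with $x_j<x_{j+1}$; $\mathrm{asc}(x)$ is the number of ascents. An ascent sequence of length $n$ is a sequence $x_1\cdots x_n$ of non-negative integers with $x_1=0$ and $x_i\le\mathrm{asc}(x_1\cdots x_{i-1})+1$ for $1<i\le n$. A sequence $\pi$ contains a pattern $\tau=\tau_1\cdots\tau_m$ (a sequence of non-negative integers) if there are indices $f(1)<\cdots<f(m)$ such that for all $i,j$: $\pi_{f(i)}<\pi_{f(j)}$ iff $\tau_i<\tau_j$, and $\pi_{f(i)}>\pi_{f(j)}$ iff $\tau_i>\tau_j$; otherwise $\pi$ avoids $\tau$. $\mathcal{S}_{0012}(n)$ is the set of ascent sequences of length $n$ avoiding $0012$. $\mathrm{fwd}(x)$ is the length of the maximal final weakly decreasing segment of $x$. Let $b_{n,m,r,\ell}$ be the number of $\pi\in\mathcal{S}_{0012}(n)$ not ending in $0$ with exactly $m$ ascents, $r$ zeros and $\mathrm{fwd}(\pi)=\ell$, and define the polynomial $B_{n,m}(u,v)=\sum_{r,\ell\ge1}b_{n,m,r,\ell}u^\ell v^r$ (which is $0$ unless $1\le m\le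 n-1$). The expression $\frac{uB_{n-1,m-1}(1,v)-B_{n-1,m-1}(u,v)}{1-u}$ is a polynomial in $u,v$. -}

module Defs where

open import Data.Bool using (Bool; true; false; _∧_; _∨_; not; if_then_else_)
open import Data.Nat as ℕ using (ℕ; zero; suc; _∸_; _<ᵇ_; _≤ᵇ_; _≡ᵇ_)
open import Data.List using (List; []; _∷_; _++_; [_]; length; map; concatMap; filter; zip; reverse; upTo)
open import Data.Bool.ListAction using (all; any)
open import Data.Product using (_×_; _,_)
open import Data.Integer as ℤ using (ℤ; +_)

asc : List ℕ → ℕ
asc (x ∷ y ∷ xs) = (if x <ᵇ y then 1 else 0) ℕ.+ asc (y ∷ xs)
asc _ = 0

ascOK : List ℕ → List ℕ → Bool
ascOK p [] = true
ascOK [] (x ∷ r) = (x ≡ᵇ 0) ∧ ascOK [ x ] r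
ascOK p@(_ ∷ _) (x ∷ r) = (x ≤ᵇ (asc p ℕ.+ 1)) ∧ ascOK (p ++ [ x ]) r

isAscentSeq : List ℕ → Bool
isAscentSeq = ascOK []

lists : ℕ → ℕ → List (List ℕ)
lists zero    k = [ [] ]
lists (suc n) k = concatMap (λ xs → map (λ a → a ∷ xs) (upTo k)) (lists n k)

-- all ascent sequences of length n (their entries are < n, so this is complete)
ascentSeqs : ℕ → List (List ℕ)
ascentSeqs n = filter (λ x → Data.Bool.T? (isAscentSeq x)) (lists n n)
  where import Data.Bool

subseqs : ℕ → List ℕ → List (List ℕ)
subseqs zero    xs       = [ [] ]
subseqs (suc k) []       = []
subseqs (suc k) (x ∷ xs) = map (x ∷_) (subseqs k xs) ++ subseqs (suc k) xs

cmp : ℕ → ℕ → ℕ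
cmp a b = if a <ᵇ b then 0 else (if a ≡ᵇ b then 1 else 2)

orderIso : List ℕ → List ℕ → Bool
orderIso σ τ = (length σ ≡ᵇ length τ) ∧
  all (λ { (a , c) → all (λ { (b , d) → cmp a b ≡ᵇ cmp c d }) ps }) ps
  where ps = zip σ τ

contains : List ℕ → List ℕ → Bool
contains π τ = any (λ σ → orderIso σ τ) (subseqs (length τ) π)

avoids : List ℕ → List ℕ → Bool
avoids π τ = not (contains π τ)

zeros : List ℕ → ℕ
zeros []       = 0
zeros (x ∷ xs) = (if x ≡ᵇ 0 then 1 else 0) ℕ.+ zeros xs

fwdRev : List ℕ → ℕ
fwdRev []           = 0
fwdRev (x ∷ [])     = 1
fwdRev (x ∷ y ∷ xs) = if x ≤ᵇ y then suc (fwdRev (y ∷ xs)) else 1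

fwd : List ℕ → ℕ
fwd x = fwdRev (reverse x)

endsInZero : List ℕ → Bool
endsInZero x with reverse x
... | []    = false
... | y ∷ _ = y ≡ᵇ 0

pat0012 : List ℕ
pat0012 = 0 ∷ 0 ∷ 1 ∷ 2 ∷ []

b : ℕ → ℕ → ℕ → ℕ → ℕ
b n m r ℓ = length (filter (λ π → Data.Bool.T? (
    avoids π pat0012 ∧ not (endsInZero π) ∧
    (asc π ≡ᵇ m) ∧ (zeros π ≡ᵇ r) ∧ (fwd π ≡ᵇ ℓ))) (ascentSeqs n))
  where import Data.Bool

sumFrom : ℕ → ℕ → (ℕ → ℤ) → ℤ
sumFrom lo zero    f = + 0
sumFrom lo (suc k) f = f lo ℤ.+ sumFrom (suc lo) k f

-- B_{n,m}(u,v) = Σ_{r,ℓ ≥ 1} b_{n,m,r,ℓ} u^ℓ v^r.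
-- Since r ≤ n and ℓ ≤ n for sequences of length n, the sums run over 1 ≤ r, ℓ ≤ n.
B : ℕ → ℕ → ℤ → ℤ → ℤ
B n m u v = sumFrom 1 n (λ r → sumFrom 1 n (λ ℓ →
  (+ b n m r ℓ) ℤ.* (u ℤ.^ ℓ) ℤ.* (v ℤ.^ r)))

-- Every π counted by B_{n,m} starts with 0.  If that is its only zero, π = 0(ρ+1) for an
-- arbitrary 0012-avoiding ascent sequence ρ with m-1 ascents; writing ρ = τ0^j with τ not
-- ending in 0, the trailing zeros lengthen the final weakly decreasing run of τ by j, giving
-- v ∑_j u^j B_{n-j-1,m-1}(u,1).  Otherwise the entry just before the final run is 0: a positive
-- entry there is smaller than the next one and would complete a 0012 with two earlier zeros
-- (the run itself has no zero, as π does not end in 0).  Deleting this 0 costs a factor v.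
-- If the entry before this 0 is smaller than the first entry of the run, asc and fwd are kept,
-- giving v B_{n-1,m}(u,v).  Otherwise one ascent is lost and the run, of length k, becomes a
-- proper suffix of the final run of the new sequence σ; every 1 ≤ k < fwd σ arises, and
-- ∑_{1≤k<f} u^k = (u - u^f)/(1 - u) gives v (u B_{n-1,m-1}(1,v) - B_{n-1,m-1}(u,v))/(1 - u).
-- For m = 1 the same decomposition reads B_{n,1} = v u^{n-1} + v B_{n-1,1}.

module Submission where

open import Defs
open import Data.Bool using (Bool; true; false; _∧_; _∨_; not; if_then_else_; T)
import Data.Bool.Properties as BP
open import Data.Bool.ListAction using (all)
open import Data.Empty using (⊥-elim)
open import Data.Integer using (ℤ; +_; _+_; _*_; _-_; _^_; -_)
import Data.Integer.Properties as ℤP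
open import Data.Integer.Tactic.RingSolver using (solve-∀)
open import Data.List using (List; []; _∷_; _++_; [_]; length; map; concatMap; filter; replicate; reverse; upTo; applyUpTo)
import Data.List.Properties as LP
open import Data.List.Membership.Propositional using (_∈_; find; lose)
open import Data.List.Membership.Propositional.Properties using (∈-map⁺; ∈-map⁻; ∈-++⁺ˡ; ∈-++⁺ʳ; ∈-++⁻)
open import Data.List.Relation.Binary.Sublist.Propositional using (_⊆_; []; _∷_; _∷ʳ_; minimum; lookup; from∈)
open import Data.List.Relation.Binary.Sublist.Propositional.Properties using (++⁺; map⁺; ∷ˡ⁻)
open import Data.List.Relation.Unary.All as All using (All; []; _∷_)
import Data.List.Relation.Unary.All.Properties as AllP
open import Data.List.Relation.Unary.Any using (here; there)
import Data.List.Relation.Unary.Any.Properties as AnyP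
open import Data.Nat as ℕ using (ℕ; zero; suc; _∸_; _<ᵇ_; _≤ᵇ_; _≡ᵇ_; _≤_; _<_; z≤n; s≤s)
import Data.Nat.Properties as ℕP
open import Data.Product using (∃; ∃₂; _×_; _,_; proj₁; proj₂)
open import Data.Sum using (inj₁; inj₂)
open import Function using (_∘_; Equivalence)
open import Relation.Nullary using (yes; no)
open import Relation.Nullary.Decidable.Core using (T?)
open import Relation.Binary.PropositionalEquality hiding ([_])
open ≡-Reasoning
open import Algebra.Properties.CommutativeSemigroup ℤP.+-commutativeSemigroup using () renaming (interchange to +-interchange)

T⇒≡true : ∀ {b} → T b → b ≡ true
T⇒≡true = Equivalence.to BP.T-≡

≡true⇒T : ∀ {b} → b ≡ true → T b
≡true⇒T = Equivalence.from BP.T-≡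

≡ᵇ-refl : ∀ n → (n ≡ᵇ n) ≡ true
≡ᵇ-refl n = T⇒≡true (ℕP.≡⇒≡ᵇ n n refl)

≡ᵇ≡true⇒≡ : ∀ m n → (m ≡ᵇ n) ≡ true → m ≡ n
≡ᵇ≡true⇒≡ m n e = ℕP.≡ᵇ⇒≡ m n (≡true⇒T e)

≢⇒≡ᵇ≡false : ∀ {m n} → m ≢ n → (m ≡ᵇ n) ≡ false
≢⇒≡ᵇ≡false {m} {n} m≢n with m ≡ᵇ n in e
... | false = refl
... | true  = ⊥-elim (m≢n (≡ᵇ≡true⇒≡ m n e))

<⇒≡ᵇ≡false : ∀ {m n} → m < n → (m ≡ᵇ n) ≡ false
<⇒≡ᵇ≡false m<n = ≢⇒≡ᵇ≡false (ℕP.<⇒≢ m<n)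

>⇒≡ᵇ≡false : ∀ {m n} → n < m → (m ≡ᵇ n) ≡ false
>⇒≡ᵇ≡false n<m = ≢⇒≡ᵇ≡false (ℕP.>⇒≢ n<m)

<ᵇ≡true⇒< : ∀ m n → (m <ᵇ n) ≡ true → m < n
<ᵇ≡true⇒< m n e = ℕP.<ᵇ⇒< m n (≡true⇒T e)

<⇒<ᵇ≡true : ∀ {m n} → m < n → (m <ᵇ n) ≡ true
<⇒<ᵇ≡true m<n = T⇒≡true (ℕP.<⇒<ᵇ m<n)

<ᵇ≡false⇒≥ : ∀ m n → (m <ᵇ n) ≡ false → n ≤ m
<ᵇ≡false⇒≥ m n e = ℕP.≮⇒≥ (λ m<n → subst T e (ℕP.<⇒<ᵇ m<n))

≥⇒<ᵇ≡false : ∀ {m n} → n ≤ m → (m <ᵇ n) ≡ false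
≥⇒<ᵇ≡false {m} {n} n≤m with m <ᵇ n in e
... | false = refl
... | true  = ⊥-elim (ℕP.<⇒≱ (<ᵇ≡true⇒< m n e) n≤m)

≤ᵇ≡true⇒≤ : ∀ m n → (m ≤ᵇ n) ≡ true → m ≤ n
≤ᵇ≡true⇒≤ m n e = ℕP.≤ᵇ⇒≤ m n (≡true⇒T e)

≤⇒≤ᵇ≡true : ∀ {m n} → m ≤ n → (m ≤ᵇ n) ≡ true
≤⇒≤ᵇ≡true m≤n = T⇒≡true (ℕP.≤⇒≤ᵇ m≤n)

≤ᵇ≡false⇒> : ∀ m n → (m ≤ᵇ n) ≡ false → n < m
≤ᵇ≡false⇒> m n e = ℕP.≰⇒> (λ m≤n → subst T e (ℕP.≤⇒≤ᵇ m≤n))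

>⇒≤ᵇ≡false : ∀ {m n} → n < m → (m ≤ᵇ n) ≡ false
>⇒≤ᵇ≡false {m} {n} n<m with m ≤ᵇ n in e
... | false = refl
... | true  = ⊥-elim (ℕP.<⇒≱ n<m (≤ᵇ≡true⇒≤ m n e))

∧≡true⇒ : ∀ x y → x ∧ y ≡ true → x ≡ true × y ≡ true
∧≡true⇒ true y e = refl , e

𝟙 : Bool → ℤ
𝟙 true  = + 1
𝟙 false = + 0

𝟙-∧ : ∀ x y → 𝟙 (x ∧ y) ≡ 𝟙 x * 𝟙 y
𝟙-∧ true  y = sym (ℤP.*-identityˡ _)
𝟙-∧ false y = refl

𝟙-false : ∀ {b} (X : ℤ) → b ≡ false → 𝟙 b * X ≡ + 0
𝟙-false X refl = ℤP.*-zeroˡ X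

𝟙-true : ∀ {b} (X : ℤ) → b ≡ true → 𝟙 b * X ≡ X
𝟙-true X refl = ℤP.*-identityˡ X

𝟙-split : ∀ b X → X ≡ 𝟙 b * X + 𝟙 (not b) * X
𝟙-split true  X = sym (trans (cong₂ _+_ (ℤP.*-identityˡ X) (ℤP.*-zeroˡ X)) (ℤP.+-identityʳ X))
𝟙-split false X = sym (trans (cong₂ _+_ (ℤP.*-zeroˡ X) (ℤP.*-identityˡ X)) (ℤP.+-identityˡ X))

∑ : {A : Set} → List A → (A → ℤ) → ℤ
∑ []       f = + 0
∑ (x ∷ xs) f = f x + ∑ xs f

module _ {A : Set} where

  ∑-cong : (xs : List A) {f g : A → ℤ} → (∀ x → f x ≡ g x) → ∑ xs f ≡ ∑ xs g
  ∑-cong []       h = refl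
  ∑-cong (x ∷ xs) h = cong₂ _+_ (h x) (∑-cong xs h)

  ∑-congᴬ : (xs : List A) {f g : A → ℤ} → All (λ x → f x ≡ g x) xs → ∑ xs f ≡ ∑ xs g
  ∑-congᴬ []       []       = refl
  ∑-congᴬ (x ∷ xs) (h ∷ hs) = cong₂ _+_ h (∑-congᴬ xs hs)

  ∑-++ : (xs ys : List A) (f : A → ℤ) → ∑ (xs ++ ys) f ≡ ∑ xs f + ∑ ys f
  ∑-++ []       ys f = sym (ℤP.+-identityˡ _)
  ∑-++ (x ∷ xs) ys f = trans (cong (_+_ (f x)) (∑-++ xs ys f)) (sym (ℤP.+-assoc (f x) _ _))

  ∑-+ : (xs : List A) (f g : A → ℤ) → ∑ xs (λ x → f x + g x) ≡ ∑ xs f + ∑ xs g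
  ∑-+ []       f g = refl
  ∑-+ (x ∷ xs) f g = trans (cong (_+_ (f x + g x)) (∑-+ xs f g)) (+-interchange (f x) (g x) _ _)

  ∑-*ˡ : (xs : List A) (c : ℤ) (f : A → ℤ) → ∑ xs (λ x → c * f x) ≡ c * ∑ xs f
  ∑-*ˡ []       c f = sym (ℤP.*-zeroʳ c)
  ∑-*ˡ (x ∷ xs) c f rewrite ∑-*ˡ xs c f = sym (ℤP.*-distribˡ-+ c (f x) _)

  ∑-*ʳ : (xs : List A) (c : ℤ) (f : A → ℤ) → ∑ xs (λ x → f x * c) ≡ ∑ xs f * c
  ∑-*ʳ xs c f = trans (∑-cong xs (λ x → ℤP.*-comm (f x) c)) (trans (∑-*ˡ xs c f) (ℤP.*-comm c (∑ xs f)))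

  ∑-neg : (xs : List A) (f : A → ℤ) → ∑ xs (λ x → - f x) ≡ - ∑ xs f
  ∑-neg []       f = refl
  ∑-neg (x ∷ xs) f rewrite ∑-neg xs f = sym (ℤP.neg-distrib-+ (f x) _)

  ∑-zero : (xs : List A) {f : A → ℤ} → (∀ x → f x ≡ + 0) → ∑ xs f ≡ + 0
  ∑-zero []       h = refl
  ∑-zero (x ∷ xs) h rewrite h x = trans (ℤP.+-identityˡ _) (∑-zero xs h)

  ∑-linear-sub : (xs : List A) (c : ℤ) (f g : A → ℤ) →
                 c * ∑ xs f - ∑ xs g ≡ ∑ xs (λ x → c * f x - g x)
  ∑-linear-sub xs c f g = sym (trans (∑-+ xs _ _) (cong₂ _+_ (∑-*ˡ xs c f) (∑-neg xs g)))

module _ {A B : Set} where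

  ∑-map : (g : A → B) (xs : List A) (f : B → ℤ) → ∑ (map g xs) f ≡ ∑ xs (f ∘ g)
  ∑-map g []       f = refl
  ∑-map g (x ∷ xs) f = cong (_+_ (f (g x))) (∑-map g xs f)

  ∑-concatMap : (g : A → List B) (xs : List A) (f : B → ℤ) →
                ∑ (concatMap g xs) f ≡ ∑ xs (λ x → ∑ (g x) f)
  ∑-concatMap g []       f = refl
  ∑-concatMap g (x ∷ xs) f =
    trans (∑-++ (g x) (concatMap g xs) f) (cong (_+_ (∑ (g x) f)) (∑-concatMap g xs f))

  ∑-comm : (xs : List A) (ys : List B) (f : A → B → ℤ) →
           ∑ xs (λ x → ∑ ys (f x)) ≡ ∑ ys (λ y → ∑ xs (λ x → f x y))
  ∑-comm []       ys f = sym (∑-zero ys (λ _ → refl))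
  ∑-comm (x ∷ xs) ys f =
    trans (cong (_+_ (∑ ys (f x))) (∑-comm xs ys f)) (sym (∑-+ ys (f x) _))

range : ℕ → ℕ → List ℕ
range lo zero    = []
range lo (suc k) = lo ∷ range (suc lo) k

sumFrom≡∑range : ∀ lo k f → sumFrom lo k f ≡ ∑ (range lo k) f
sumFrom≡∑range lo zero    f = refl
sumFrom≡∑range lo (suc k) f = cong (_+_ (f lo)) (sumFrom≡∑range (suc lo) k f)

range-suc : ∀ lo k → range (suc lo) k ≡ map suc (range lo k)
range-suc lo zero    = refl
range-suc lo (suc k) = cong (suc lo ∷_) (range-suc (suc lo) k)

range-bounds : ∀ lo k → All (λ i → lo ≤ i × i < lo ℕ.+ k) (range lo k)
range-bounds lo zero    = []
range-bounds lo (suc k) =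
  (ℕP.≤-refl , ℕP.m<m+n lo (s≤s z≤n)) ∷
  All.map (λ {i} (lo<i , i<lo+1+k) → ℕP.<⇒≤ lo<i , subst (i <_) (sym (ℕP.+-suc lo k)) i<lo+1+k)
          (range-bounds (suc lo) k)

applyUpTo≡map-range : {A : Set} (f : ℕ → A) (n : ℕ) → applyUpTo f n ≡ map f (range 0 n)
applyUpTo≡map-range f zero    = refl
applyUpTo≡map-range f (suc n) = cong (f 0 ∷_) (begin
  applyUpTo (f ∘ suc) n       ≡⟨ applyUpTo≡map-range (f ∘ suc) n ⟩
  map (f ∘ suc) (range 0 n)   ≡⟨ LP.map-∘ {g = f} {f = suc} (range 0 n) ⟩
  map f (map suc (range 0 n)) ≡⟨ cong (map f) (range-suc 0 n) ⟨
  map f (range 1 n)           ∎)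

∑-upTo : ∀ n (f : ℕ → ℤ) → ∑ (upTo n) f ≡ ∑ (range 0 n) f
∑-upTo n f = trans (cong (λ l → ∑ l f) (applyUpTo≡map-range (λ x → x) n)) (∑-map (λ x → x) (range 0 n) f)

∑-range-suc : ∀ lo k (f : ℕ → ℤ) → ∑ (range (suc lo) k) f ≡ ∑ (range lo k) (f ∘ suc)
∑-range-suc lo k f = trans (cong (λ l → ∑ l f) (range-suc lo k)) (∑-map suc (range lo k) f)

∑-range-+ : ∀ lo a b (f : ℕ → ℤ) → ∑ (range lo (a ℕ.+ b)) f ≡ ∑ (range lo a) f + ∑ (range (lo ℕ.+ a) b) f
∑-range-+ lo zero    b f rewrite ℕP.+-identityʳ lo = sym (ℤP.+-identityˡ _)
∑-range-+ lo (suc a) b f rewrite ∑-range-+ (suc lo) a b f | ℕP.+-suc lo a = sym (ℤP.+-assoc (f lo) _ _)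

∑-range-cong : ∀ lo k {f g : ℕ → ℤ} → (∀ i → lo ≤ i → i < lo ℕ.+ k → f i ≡ g i) →
               ∑ (range lo k) f ≡ ∑ (range lo k) g
∑-range-cong lo k h = ∑-congᴬ (range lo k) (All.map (λ (p , q) → h _ p q) (range-bounds lo k))

∑-upTo-suc : ∀ K (g : ℕ → ℤ) → ∑ (upTo (suc K)) g ≡ g 0 + ∑ (upTo K) (g ∘ suc)
∑-upTo-suc K g =
  trans (∑-upTo (suc K) g) (cong (_+_ (g 0)) (trans (∑-range-suc 0 K g) (sym (∑-upTo K (g ∘ suc)))))

∑-upTo-head : ∀ K (g : ℕ → ℤ) → (∀ y → g (suc y) ≡ + 0) → ∑ (upTo (suc K)) g ≡ g 0
∑-upTo-head K g h =
  trans (∑-upTo-suc K g) (trans (cong (_+_ (g 0)) (∑-zero (upTo K) h)) (ℤP.+-identityʳ _))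

-- Sums over all words of a given length

∑-lists-suc : ∀ l N (f : List ℕ → ℤ) →
              ∑ (lists (suc l) N) f ≡ ∑ (lists l N) (λ xs → ∑ (upTo N) (λ x → f (x ∷ xs)))
∑-lists-suc l N f =
  trans (∑-concatMap _ (lists l N) f) (∑-cong (lists l N) (λ xs → ∑-map (_∷ xs) (upTo N) f))

lists-length : ∀ l N → All (λ xs → length xs ≡ l) (lists l N)
lists-length zero    N = refl ∷ []
lists-length (suc l) N =
  AllP.concat⁺ (AllP.map⁺ (All.map (λ e → AllP.map⁺ (All.universal (λ _ → cong suc e) _)) (lists-length l N)))

∑-lists-cong : ∀ l N {f g : List ℕ → ℤ} → (∀ xs → length xs ≡ l → f xs ≡ g xs) →
               ∑ (lists l N) f ≡ ∑ (lists l N) g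
∑-lists-cong l N h = ∑-congᴬ (lists l N) (All.map (h _) (lists-length l N))

∑-lists-++ : ∀ a b N (H : List ℕ → ℤ) →
             ∑ (lists (a ℕ.+ b) N) H ≡ ∑ (lists a N) (λ α → ∑ (lists b N) (λ β → H (α ++ β)))
∑-lists-++ zero    b N H = sym (ℤP.+-identityʳ _)
∑-lists-++ (suc a) b N H = begin
  ∑ (lists (suc a ℕ.+ b) N) H
    ≡⟨ ∑-lists-suc (a ℕ.+ b) N H ⟩
  ∑ (lists (a ℕ.+ b) N) (λ γ → ∑ (upTo N) (λ x → H (x ∷ γ)))
    ≡⟨ ∑-lists-++ a b N _ ⟩
  ∑ (lists a N) (λ α → ∑ (lists b N) (λ β → ∑ (upTo N) (λ x → H (x ∷ α ++ β))))
    ≡⟨ ∑-cong (lists a N) (λ α → ∑-comm (lists b N) (upTo N) _) ⟩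
  ∑ (lists a N) (λ α → ∑ (upTo N) (λ x → ∑ (lists b N) (λ β → H (x ∷ α ++ β))))
    ≡⟨ ∑-lists-suc a N _ ⟨
  ∑ (lists (suc a) N) (λ α → ∑ (lists b N) (λ β → H (α ++ β))) ∎

∑-lists-split : ∀ a b {L} N (H : List ℕ → ℤ) → a ℕ.+ b ≡ L →
                ∑ (lists L N) H ≡ ∑ (lists a N) (λ α → ∑ (lists b N) (λ β → H (α ++ β)))
∑-lists-split a b N H refl = ∑-lists-++ a b N H

∑-lists-head0 : ∀ l K (f : List ℕ → ℤ) → (∀ y σ → f (suc y ∷ σ) ≡ + 0) →
                ∑ (lists (suc l) (suc K)) f ≡ ∑ (lists l (suc K)) (λ σ → f (0 ∷ σ))
∑-lists-head0 l K f h =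
  trans (∑-lists-suc l (suc K) f)
        (∑-cong (lists l (suc K)) (λ σ → ∑-upTo-head K (λ x → f (x ∷ σ)) (λ y → h y σ)))

zeroFree : List ℕ → Bool
zeroFree []           = true
zeroFree (zero  ∷ xs) = false
zeroFree (suc _ ∷ xs) = zeroFree xs

allZero : List ℕ → Bool
allZero []           = true
allZero (zero  ∷ xs) = allZero xs
allZero (suc _ ∷ xs) = false

zeroFree-++ : ∀ δ ε → zeroFree (δ ++ ε) ≡ zeroFree δ ∧ zeroFree ε
zeroFree-++ []          ε = refl
zeroFree-++ (zero  ∷ δ) ε = refl
zeroFree-++ (suc x ∷ δ) ε = zeroFree-++ δ ε

allZero-++ : ∀ δ ε → allZero (δ ++ ε) ≡ allZero δ ∧ allZero ε
allZero-++ []          ε = refl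
allZero-++ (zero  ∷ δ) ε = allZero-++ δ ε
allZero-++ (suc x ∷ δ) ε = refl

∑-lists-zeroFree : ∀ L K (F : List ℕ → ℤ) →
                   ∑ (lists L (suc K)) (λ σ → 𝟙 (zeroFree σ) * F σ) ≡ ∑ (lists L K) (λ ρ → F (map suc ρ))
∑-lists-zeroFree zero    K F = trans (ℤP.+-identityʳ _) (trans (ℤP.*-identityˡ (F [])) (sym (ℤP.+-identityʳ (F []))))
∑-lists-zeroFree (suc L) K F = begin
  ∑ (lists (suc L) (suc K)) (λ σ → 𝟙 (zeroFree σ) * F σ)
    ≡⟨ ∑-lists-suc L (suc K) _ ⟩
  ∑ (lists L (suc K)) (λ xs → ∑ (upTo (suc K)) (λ x → 𝟙 (zeroFree (x ∷ xs)) * F (x ∷ xs)))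
    ≡⟨ ∑-cong (lists L (suc K)) drop-zero-head ⟩
  ∑ (lists L (suc K)) (λ xs → 𝟙 (zeroFree xs) * ∑ (upTo K) (λ x → F (suc x ∷ xs)))
    ≡⟨ ∑-lists-zeroFree L K _ ⟩
  ∑ (lists L K) (λ ρ → ∑ (upTo K) (λ x → F (suc x ∷ map suc ρ)))
    ≡⟨ ∑-lists-suc L K _ ⟨
  ∑ (lists (suc L) K) (λ ρ → F (map suc ρ)) ∎
  where
  drop-zero-head : ∀ xs → ∑ (upTo (suc K)) (λ x → 𝟙 (zeroFree (x ∷ xs)) * F (x ∷ xs))
                          ≡ 𝟙 (zeroFree xs) * ∑ (upTo K) (λ x → F (suc x ∷ xs))
  drop-zero-head xs =
    trans (∑-upTo-suc K (λ x → 𝟙 (zeroFree (x ∷ xs)) * F (x ∷ xs)))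
    (trans (cong (_+ ∑ (upTo K) (λ x → 𝟙 (zeroFree xs) * F (suc x ∷ xs))) (ℤP.*-zeroˡ (F (0 ∷ xs))))
    (trans (ℤP.+-identityˡ _) (∑-*ˡ (upTo K) (𝟙 (zeroFree xs)) _)))

∑-lists-allZero : ∀ j K (H : List ℕ → ℤ) →
                  ∑ (lists j (suc K)) (λ β → 𝟙 (allZero β) * H β) ≡ H (replicate j 0)
∑-lists-allZero zero    K H = trans (ℤP.+-identityʳ _) (ℤP.*-identityˡ (H []))
∑-lists-allZero (suc j) K H =
  trans (∑-lists-suc j (suc K) _)
  (trans (∑-cong (lists j (suc K)) (λ xs →
           ∑-upTo-head K (λ x → 𝟙 (allZero (x ∷ xs)) * H (x ∷ xs)) (λ y → ℤP.*-zeroˡ (H (suc y ∷ xs)))))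
  (∑-lists-allZero j K (λ xs → H (0 ∷ xs))))

hasEntry≥ : ℕ → List ℕ → Bool
hasEntry≥ k []       = false
hasEntry≥ k (x ∷ xs) = (k ≤ᵇ x) ∨ hasEntry≥ k xs

∑-lists-restrict : ∀ l {N k} → k ≤ N → (f : List ℕ → ℤ) →
                   (∀ xs → length xs ≡ l → hasEntry≥ k xs ≡ true → f xs ≡ + 0) →
                   ∑ (lists l N) f ≡ ∑ (lists l k) f
∑-lists-restrict zero    k≤N f h = refl
∑-lists-restrict (suc l) {N} {k} k≤N f h =
  trans (∑-lists-suc l N f)
  (trans (∑-lists-restrict l k≤N _ big-tail)
  (trans (∑-lists-cong l k head-restrict) (sym (∑-lists-suc l k f))))
  where
  big-tail : ∀ xs → length xs ≡ l → hasEntry≥ k xs ≡ true → ∑ (upTo N) (λ x → f (x ∷ xs)) ≡ + 0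
  big-tail xs e b = ∑-zero (upTo N) (λ x → h (x ∷ xs) (cong suc e) (trans (cong ((k ≤ᵇ x) ∨_) b) (BP.∨-zeroʳ _)))
  head-restrict : ∀ xs → length xs ≡ l → ∑ (upTo N) (λ x → f (x ∷ xs)) ≡ ∑ (upTo k) (λ x → f (x ∷ xs))
  head-restrict xs e = begin
    ∑ (upTo N) g                                      ≡⟨ ∑-upTo N g ⟩
    ∑ (range 0 N) g                                   ≡⟨ cong (λ n → ∑ (range 0 n) g) (ℕP.m+[n∸m]≡n k≤N) ⟨
    ∑ (range 0 (k ℕ.+ (N ∸ k))) g                     ≡⟨ ∑-range-+ 0 k (N ∸ k) g ⟩
    ∑ (range 0 k) g + ∑ (range k (N ∸ k)) g           ≡⟨ cong (_+_ (∑ (range 0 k) g)) big-head ⟩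
    ∑ (range 0 k) g + + 0                             ≡⟨ ℤP.+-identityʳ _ ⟩
    ∑ (range 0 k) g                                   ≡⟨ ∑-upTo k g ⟨
    ∑ (upTo k) g                                      ∎
    where
    g = λ x → f (x ∷ xs)
    big-head : ∑ (range k (N ∸ k)) g ≡ + 0
    big-head = trans (∑-range-cong k (N ∸ k) {g = λ _ → + 0}
                 (λ x k≤x _ → h (x ∷ xs) (cong suc e) (cong (_∨ hasEntry≥ k xs) (≤⇒≤ᵇ≡true k≤x))))
                 (∑-zero (range k (N ∸ k)) (λ _ → refl))

∑-range-select : ∀ lo k x (g : ℕ → ℤ) → lo ≤ x → x < lo ℕ.+ k →
                 ∑ (range lo k) (λ r → 𝟙 (x ≡ᵇ r) * g r) ≡ g x
∑-range-select lo zero x g lo≤x x<lo+0 =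
  ⊥-elim (ℕP.<⇒≱ x<lo+0 (subst (_≤ x) (sym (ℕP.+-identityʳ lo)) lo≤x))
∑-range-select lo (suc k) x g lo≤x x<lo+1+k with ℕP.m≤n⇒m<n∨m≡n lo≤x
... | inj₁ lo<x rewrite >⇒≡ᵇ≡false lo<x =
  trans (ℤP.+-identityˡ _) (∑-range-select (suc lo) k x g lo<x (subst (x <_) (ℕP.+-suc lo k) x<lo+1+k))
... | inj₂ refl rewrite ≡ᵇ-refl x =
  trans (cong₂ _+_ (ℤP.*-identityˡ (g x)) later-vanish) (ℤP.+-identityʳ (g x))
  where
  later-vanish : ∑ (range (suc x) k) (λ r → 𝟙 (x ≡ᵇ r) * g r) ≡ + 0
  later-vanish = trans (∑-range-cong (suc x) k {g = λ _ → + 0} (λ r x<r _ → 𝟙-false (g r) (<⇒≡ᵇ≡false x<r)))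
                       (∑-zero (range (suc x) k) (λ _ → refl))

∑-range-by-value : ∀ L (s : ℕ) (g : ℤ) → (L ≤ s → g ≡ + 0) → g ≡ ∑ (range 0 L) (λ k → 𝟙 (s ≡ᵇ k) * g)
∑-range-by-value L s g vanish with s ℕ.<? L
... | yes s<L = sym (∑-range-select 0 L s (λ _ → g) z≤n s<L)
... | no  s≮L rewrite vanish (ℕP.≮⇒≥ s≮L) = sym (∑-zero (range 0 L) (λ k → ℤP.*-zeroʳ (𝟙 (s ≡ᵇ k))))

∑-lists-by-suffix : ∀ L N (s : List ℕ → ℕ) (G : List ℕ → ℤ) →
  (∀ σ → length σ ≡ L → L < s σ → G σ ≡ + 0) →
  ∑ (lists L N) G ≡ ∑ (range 0 (suc L)) (λ k → ∑ (lists (L ∸ k) N) (λ α →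
                      ∑ (lists k N) (λ β → 𝟙 (s (α ++ β) ≡ᵇ k) * G (α ++ β))))
∑-lists-by-suffix L N s G vanish =
  trans (∑-lists-cong L N (λ σ e → ∑-range-by-value (suc L) (s σ) (G σ) (vanish σ e)))
  (trans (∑-comm (lists L N) (range 0 (suc L)) (λ σ k → 𝟙 (s σ ≡ᵇ k) * G σ))
  (∑-range-cong 0 (suc L) (λ k _ k<1+L →
    ∑-lists-split (L ∸ k) k N (λ σ → 𝟙 (s σ ≡ᵇ k) * G σ) (ℕP.m∸n+n≡m (ℕP.≤-pred k<1+L)))))

∑-lists-by-marked-suffix : ∀ L N (s : List ℕ → ℕ) (G : List ℕ → ℤ) →
  (∀ σ → length σ ≡ L → L ≤ s σ → G σ ≡ + 0) →
  ∑ (lists L N) G ≡ ∑ (range 0 L) (λ k → ∑ (lists (L ∸ suc k) N) (λ α → ∑ (upTo N) (λ x →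
                      ∑ (lists k N) (λ β → 𝟙 (s (α ++ x ∷ β) ≡ᵇ k) * G (α ++ x ∷ β)))))
∑-lists-by-marked-suffix L N s G vanish =
  trans (∑-lists-cong L N (λ σ e → ∑-range-by-value L (s σ) (G σ) (vanish σ e)))
  (trans (∑-comm (lists L N) (range 0 L) (λ σ k → 𝟙 (s σ ≡ᵇ k) * G σ))
  (∑-range-cong 0 L (λ k _ k<L →
    trans (∑-lists-split (L ∸ suc k) (suc k) N (λ σ → 𝟙 (s σ ≡ᵇ k) * G σ) (ℕP.m∸n+n≡m k<L))
    (∑-cong (lists (L ∸ suc k) N) (λ α →
      trans (∑-lists-suc k N (λ β → 𝟙 (s (α ++ β) ≡ᵇ k) * G (α ++ β)))
            (∑-comm (lists k N) (upTo N) (λ β x → 𝟙 (s (α ++ x ∷ β) ≡ᵇ k) * G (α ++ x ∷ β))))))))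

lastOr : ℕ → List ℕ → ℕ
lastOr y []       = y
lastOr y (z ∷ zs) = lastOr z zs

lastOr-++ : ∀ y δ z ε → lastOr y (δ ++ z ∷ ε) ≡ lastOr z ε
lastOr-++ y []      z ε = refl
lastOr-++ y (w ∷ δ) z ε = lastOr-++ w δ z ε

lastOr-map-suc : ∀ r ρ → lastOr (suc r) (map suc ρ) ≡ suc (lastOr r ρ)
lastOr-map-suc r []      = refl
lastOr-map-suc r (s ∷ ρ) = lastOr-map-suc s ρ

allZero⇒lastOr≡0 : ∀ s σ → allZero (s ∷ σ) ≡ true → lastOr s σ ≡ 0
allZero⇒lastOr≡0 zero    []      z = refl
allZero⇒lastOr≡0 zero    (t ∷ σ) z = allZero⇒lastOr≡0 t σ z

-- The ascent-sequence condition as an automaton whose state is (ascents so far, last entry).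
validAfter : ℕ → ℕ → List ℕ → Bool
validAfter a l []      = true
validAfter a l (x ∷ r) = (x ≤ᵇ suc a) ∧ validAfter (if l <ᵇ x then suc a else a) x r

ascAfter : ℕ → ℕ → List ℕ → ℕ
ascAfter a l []      = a
ascAfter a l (x ∷ r) = ascAfter (if l <ᵇ x then suc a else a) x r

asc-snoc : ∀ y p x → asc (y ∷ p ++ [ x ]) ≡ (if lastOr y p <ᵇ x then suc (asc (y ∷ p)) else asc (y ∷ p))
asc-snoc y [] x with y <ᵇ x
... | true  = refl
... | false = refl
asc-snoc y (z ∷ p) x rewrite asc-snoc z p x with lastOr z p <ᵇ x
... | true  = ℕP.+-suc _ _
... | false = refl

ascOK≡validAfter : ∀ y p r → ascOK (y ∷ p) r ≡ validAfter (asc (y ∷ p)) (lastOr y p) r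
ascOK≡validAfter y p []      = refl
ascOK≡validAfter y p (x ∷ r)
  rewrite ascOK≡validAfter y (p ++ [ x ]) r | asc-snoc y p x | lastOr-++ y p x [] | ℕP.+-comm (asc (y ∷ p)) 1 = refl

isAscentSeq-0∷ : ∀ r → isAscentSeq (0 ∷ r) ≡ validAfter 0 0 r
isAscentSeq-0∷ r = ascOK≡validAfter 0 [] r

validAfter-++ : ∀ a l δ γ →
                validAfter a l (δ ++ γ) ≡ validAfter a l δ ∧ validAfter (ascAfter a l δ) (lastOr l δ) γ
validAfter-++ a l []      γ = refl
validAfter-++ a l (x ∷ δ) γ rewrite validAfter-++ (if l <ᵇ x then suc a else a) x δ γ =
  sym (BP.∧-assoc (x ≤ᵇ suc a) _ _)

<ᵇ-suc : ∀ x n → (x <ᵇ suc n) ≡ (x ≤ᵇ n)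
<ᵇ-suc zero    n = refl
<ᵇ-suc (suc x) n = refl

validAfter-map-suc : ∀ a l r → validAfter (suc a) (suc l) (map suc r) ≡ validAfter a l r
validAfter-map-suc a l []      = refl
validAfter-map-suc a l (x ∷ r) rewrite <ᵇ-suc x (suc a) with l <ᵇ x
... | true  = cong (_ ∧_) (validAfter-map-suc (suc a) x r)
... | false = cong (_ ∧_) (validAfter-map-suc a x r)

validAfter-zeros : ∀ a l j → validAfter a l (replicate j 0) ≡ true
validAfter-zeros a l zero    = refl
validAfter-zeros a l (suc j) = validAfter-zeros a 0 j

ascentAt : ℕ → List ℕ → ℕ
ascentAt l []      = 0
ascentAt l (g ∷ _) = if l <ᵇ g then 1 else 0

asc-++ : ∀ y δ γ → asc (y ∷ δ ++ γ) ≡ asc (y ∷ δ) ℕ.+ ascentAt (lastOr y δ) γ ℕ.+ asc γ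
asc-++ y []      []      = refl
asc-++ y []      (g ∷ γ) = refl
asc-++ y (z ∷ δ) γ rewrite asc-++ z δ γ =
  trans (sym (ℕP.+-assoc (if y <ᵇ z then 1 else 0) _ _))
        (cong (ℕ._+ asc γ) (sym (ℕP.+-assoc (if y <ᵇ z then 1 else 0) _ _)))

asc-map-suc : ∀ r → asc (map suc r) ≡ asc r
asc-map-suc []          = refl
asc-map-suc (x ∷ [])    = refl
asc-map-suc (x ∷ y ∷ r) = cong (_ ℕ.+_) (asc-map-suc (y ∷ r))

asc-zeros : ∀ j → asc (replicate j 0) ≡ 0
asc-zeros zero          = refl
asc-zeros (suc zero)    = refl
asc-zeros (suc (suc j)) = asc-zeros (suc j)

asc<length : ∀ x xs → asc (x ∷ xs) ≤ length xs
asc<length x []       = z≤n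
asc<length x (y ∷ xs) with x <ᵇ y
... | true  = s≤s (asc<length y xs)
... | false = ℕP.m≤n⇒m≤1+n (asc<length y xs)

zeros-++ : ∀ δ γ → zeros (δ ++ γ) ≡ zeros δ ℕ.+ zeros γ
zeros-++ []      γ = refl
zeros-++ (x ∷ δ) γ = trans (cong (_ ℕ.+_) (zeros-++ δ γ)) (sym (ℕP.+-assoc (if x ≡ᵇ 0 then 1 else 0) _ _))

zeros-map-suc : ∀ r → zeros (map suc r) ≡ 0
zeros-map-suc []      = refl
zeros-map-suc (x ∷ r) = zeros-map-suc r

zeros-positive : ∀ x π → isAscentSeq (x ∷ π) ≡ true → 1 ≤ zeros (x ∷ π)
zeros-positive zero π _ = s≤s z≤n

zeros≤length : ∀ xs → zeros xs ≤ length xs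
zeros≤length []           = z≤n
zeros≤length (zero  ∷ xs) = s≤s (zeros≤length xs)
zeros≤length (suc x ∷ xs) = ℕP.m≤n⇒m≤1+n (zeros≤length xs)

weaklyDecreasing : List ℕ → Bool
weaklyDecreasing []           = true
weaklyDecreasing (x ∷ [])     = true
weaklyDecreasing (x ∷ y ∷ xs) = (y ≤ᵇ x) ∧ weaklyDecreasing (y ∷ xs)

weaklyIncreasing : List ℕ → Bool
weaklyIncreasing []           = true
weaklyIncreasing (x ∷ [])     = true
weaklyIncreasing (x ∷ y ∷ xs) = (x ≤ᵇ y) ∧ weaklyIncreasing (y ∷ xs)

headLe : List ℕ → ℕ → Bool
headLe []      x = true
headLe (y ∷ _) x = y ≤ᵇ x

lastLe : List ℕ → ℕ → Bool
lastLe []      x = true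
lastLe (y ∷ ρ) x = lastOr y ρ ≤ᵇ x

if-suc : ∀ (w : Bool) (a b : ℕ) → suc (if w then a else b) ≡ (if w then suc a else suc b)
if-suc true  a b = refl
if-suc false a b = refl

fwdRev-snoc : ∀ ρ x → fwdRev (ρ ++ [ x ]) ≡ (if weaklyIncreasing (ρ ++ [ x ]) then suc (length ρ) else fwdRev ρ)
fwdRev-snoc []      x = refl
fwdRev-snoc (y ∷ []) x with y ≤ᵇ x
... | true  = refl
... | false = refl
fwdRev-snoc (y ∷ z ∷ ρ) x with y ≤ᵇ z | fwdRev-snoc (z ∷ ρ) x
... | false | _  = refl
... | true  | ih = trans (cong suc ih) (if-suc (weaklyIncreasing (z ∷ ρ ++ [ x ])) _ _)

weaklyIncreasing-snoc : ∀ ρ x → weaklyIncreasing (ρ ++ [ x ]) ≡ weaklyIncreasing ρ ∧ lastLe ρ x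
weaklyIncreasing-snoc []          x = refl
weaklyIncreasing-snoc (y ∷ [])    x = BP.∧-identityʳ _
weaklyIncreasing-snoc (y ∷ z ∷ ρ) x rewrite weaklyIncreasing-snoc (z ∷ ρ) x = sym (BP.∧-assoc (y ≤ᵇ z) _ _)

lastLe-reverse : ∀ xs x → lastLe (reverse xs) x ≡ headLe xs x
lastLe-reverse []       x = refl
lastLe-reverse (y ∷ xs) x rewrite LP.unfold-reverse y xs = lastLe-snoc (reverse xs)
  where
  lastLe-snoc : ∀ ρ → lastLe (ρ ++ [ y ]) x ≡ (y ≤ᵇ x)
  lastLe-snoc []      = refl
  lastLe-snoc (r ∷ ρ) = cong (_≤ᵇ x) (lastOr-++ r ρ y [])

weaklyDecreasing-∷ : ∀ x xs → weaklyDecreasing (x ∷ xs) ≡ headLe xs x ∧ weaklyDecreasing xs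
weaklyDecreasing-∷ x []       = refl
weaklyDecreasing-∷ x (y ∷ xs) = refl

weaklyIncreasing-reverse : ∀ xs → weaklyIncreasing (reverse xs) ≡ weaklyDecreasing xs
weaklyIncreasing-reverse []       = refl
weaklyIncreasing-reverse (x ∷ xs)
  rewrite LP.unfold-reverse x xs | weaklyIncreasing-snoc (reverse xs) x | weaklyIncreasing-reverse xs
        | lastLe-reverse xs x | weaklyDecreasing-∷ x xs = BP.∧-comm (weaklyDecreasing xs) _

fwd-∷ : ∀ x xs → fwd (x ∷ xs) ≡ (if weaklyDecreasing (x ∷ xs) then suc (length xs) else fwd xs)
fwd-∷ x xs = begin
  fwdRev (reverse (x ∷ xs))
    ≡⟨ cong fwdRev (LP.unfold-reverse x xs) ⟩
  fwdRev (reverse xs ++ [ x ])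
    ≡⟨ fwdRev-snoc (reverse xs) x ⟩
  (if weaklyIncreasing (reverse xs ++ [ x ]) then suc (length (reverse xs)) else fwd xs)
    ≡⟨ cong₂ (λ b n → if b then suc n else fwd xs) incr (LP.length-reverse xs) ⟩
  (if weaklyDecreasing (x ∷ xs) then suc (length xs) else fwd xs) ∎
  where
  incr : weaklyIncreasing (reverse xs ++ [ x ]) ≡ weaklyDecreasing (x ∷ xs)
  incr = trans (cong weaklyIncreasing (sym (LP.unfold-reverse x xs))) (weaklyIncreasing-reverse (x ∷ xs))

reverse-∷-lastOr : ∀ y δ → ∃ λ ρ → reverse (y ∷ δ) ≡ lastOr y δ ∷ ρ
reverse-∷-lastOr y []      = [] , refl
reverse-∷-lastOr y (z ∷ δ) with reverse-∷-lastOr z δ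
... | ρ , e = ρ ++ [ y ] , trans (LP.unfold-reverse y (z ∷ δ)) (cong (_++ [ y ]) e)

endsIn0 : List ℕ → Bool
endsIn0 []      = false
endsIn0 (y ∷ δ) = lastOr y δ ≡ᵇ 0

endsIn0-∷ : ∀ x σ → endsIn0 σ ≡ true → endsIn0 (x ∷ σ) ≡ true
endsIn0-∷ x (y ∷ δ) e = e

endsInZero≡endsIn0 : ∀ x → endsInZero x ≡ endsIn0 x
endsInZero≡endsIn0 []      = refl
endsInZero≡endsIn0 (y ∷ δ) rewrite proj₂ (reverse-∷-lastOr y δ) = refl

weaklyDecreasing-++ : ∀ g δ ε → weaklyDecreasing (g ∷ δ ++ ε)
                      ≡ weaklyDecreasing (g ∷ δ) ∧ (headLe ε (lastOr g δ) ∧ weaklyDecreasing ε)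
weaklyDecreasing-++ g []      ε = weaklyDecreasing-∷ g ε
weaklyDecreasing-++ g (z ∷ δ) ε rewrite weaklyDecreasing-++ z δ ε = sym (BP.∧-assoc (z ≤ᵇ g) _ _)

weaklyDecreasing-tail : ∀ y ys → weaklyDecreasing (y ∷ ys) ≡ true → weaklyDecreasing ys ≡ true
weaklyDecreasing-tail y ys w rewrite weaklyDecreasing-∷ y ys = proj₂ (∧≡true⇒ (headLe ys y) _ w)

weaklyDecreasing-zeros : ∀ j → weaklyDecreasing (replicate j 0) ≡ true
weaklyDecreasing-zeros zero          = refl
weaklyDecreasing-zeros (suc zero)    = refl
weaklyDecreasing-zeros (suc (suc j)) = weaklyDecreasing-zeros (suc j)

weaklyDecreasing-map-suc : ∀ ρ → weaklyDecreasing (map suc ρ) ≡ weaklyDecreasing ρ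
weaklyDecreasing-map-suc []          = refl
weaklyDecreasing-map-suc (x ∷ [])    = refl
weaklyDecreasing-map-suc (x ∷ y ∷ ρ) = cong₂ _∧_ (<ᵇ-suc y x) (weaklyDecreasing-map-suc (y ∷ ρ))

weaklyDecreasing⇒asc≡0 : ∀ γ → weaklyDecreasing γ ≡ true → asc γ ≡ 0
weaklyDecreasing⇒asc≡0 []          w = refl
weaklyDecreasing⇒asc≡0 (x ∷ [])    w = refl
weaklyDecreasing⇒asc≡0 (x ∷ y ∷ γ) w =
  cong₂ (λ b n → (if b then 1 else 0) ℕ.+ n)
        (≥⇒<ᵇ≡false (≤ᵇ≡true⇒≤ y x (proj₁ parts))) (weaklyDecreasing⇒asc≡0 (y ∷ γ) (proj₂ parts))
  where parts = ∧≡true⇒ (y ≤ᵇ x) _ w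

asc≡0⇒weaklyDecreasing : ∀ γ → asc γ ≡ 0 → weaklyDecreasing γ ≡ true
asc≡0⇒weaklyDecreasing []          e = refl
asc≡0⇒weaklyDecreasing (x ∷ [])    e = refl
asc≡0⇒weaklyDecreasing (x ∷ y ∷ γ) e =
  cong₂ _∧_ (≤⇒≤ᵇ≡true (<ᵇ≡false⇒≥ x y (no-ascent (x <ᵇ y) (ℕP.m+n≡0⇒m≡0 _ e))))
            (asc≡0⇒weaklyDecreasing (y ∷ γ) (ℕP.m+n≡0⇒n≡0 (if x <ᵇ y then 1 else 0) e))
  where
  no-ascent : ∀ b → (if b then 1 else 0) ≡ 0 → b ≡ false
  no-ascent false _ = refl

allZero⇒≡replicate : ∀ xs → allZero xs ≡ true → xs ≡ replicate (length xs) 0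
allZero⇒≡replicate []       e = refl
allZero⇒≡replicate (zero ∷ xs) e = cong (0 ∷_) (allZero⇒≡replicate xs e)

no-ascents⇒allZero : ∀ ρ → isAscentSeq ρ ≡ true → asc ρ ≡ 0 → allZero ρ ≡ true
no-ascents⇒allZero []       _ _ = refl
no-ascents⇒allZero (zero ∷ ρ) _ e = zero-head ρ (asc≡0⇒weaklyDecreasing (0 ∷ ρ) e)
  where
  zero-head : ∀ δ → weaklyDecreasing (0 ∷ δ) ≡ true → allZero δ ≡ true
  zero-head []       w = refl
  zero-head (zero ∷ δ) w = zero-head δ w

weaklyDecreasing⇒endsIn0 : ∀ σ → weaklyDecreasing σ ≡ true → zeroFree σ ≡ false → endsIn0 σ ≡ true
weaklyDecreasing⇒endsIn0 (zero  ∷ [])        w z = refl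
weaklyDecreasing⇒endsIn0 (zero  ∷ zero ∷ σ)  w z = weaklyDecreasing⇒endsIn0 (zero ∷ σ) w z
weaklyDecreasing⇒endsIn0 (suc x ∷ [])        w ()
weaklyDecreasing⇒endsIn0 (suc x ∷ y ∷ σ)     w z =
  weaklyDecreasing⇒endsIn0 (y ∷ σ) (weaklyDecreasing-tail (suc x) (y ∷ σ) w) z

weaklyDecreasing⇒zeroFree : ∀ σ → weaklyDecreasing σ ≡ true → endsIn0 σ ≡ false → zeroFree σ ≡ true
weaklyDecreasing⇒zeroFree σ w e with zeroFree σ in z
... | true  = refl
... | false with trans (sym (weaklyDecreasing⇒endsIn0 σ w z)) e
... | ()

fwd≤length : ∀ xs → fwd xs ≤ length xs
fwd≤length []       = z≤n
fwd≤length (x ∷ xs) rewrite fwd-∷ x xs with weaklyDecreasing (x ∷ xs)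
... | true  = ℕP.≤-refl
... | false = ℕP.m≤n⇒m≤1+n (fwd≤length xs)

fwd-positive : ∀ x xs → 1 ≤ fwd (x ∷ xs)
fwd-positive x []       = s≤s z≤n
fwd-positive x (y ∷ xs) rewrite fwd-∷ x (y ∷ xs) with weaklyDecreasing (x ∷ y ∷ xs)
... | true  = s≤s z≤n
... | false = fwd-positive y xs

fwd-weaklyDecreasing : ∀ xs → weaklyDecreasing xs ≡ true → fwd xs ≡ length xs
fwd-weaklyDecreasing []       w = refl
fwd-weaklyDecreasing (x ∷ xs) w rewrite fwd-∷ x xs | w = refl

fwd<length : ∀ xs → weaklyDecreasing xs ≡ false → fwd xs < length xs
fwd<length (x ∷ xs) w rewrite fwd-∷ x xs | w = s≤s (fwd≤length xs)

fwd-++ʳ : ∀ γ ε → weaklyDecreasing ε ≡ false → fwd (γ ++ ε) ≡ fwd ε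
fwd-++ʳ []      ε w = refl
fwd-++ʳ (g ∷ γ) ε w
  rewrite fwd-∷ g (γ ++ ε) | weaklyDecreasing-++ g γ ε | w
        | BP.∧-zeroʳ (headLe ε (lastOr g γ)) | BP.∧-zeroʳ (weaklyDecreasing (g ∷ γ)) = fwd-++ʳ γ ε w

fwd-after-ascent : ∀ g δ e ε → weaklyDecreasing (e ∷ ε) ≡ true → (lastOr g δ <ᵇ e) ≡ true →
                   fwd (g ∷ δ ++ e ∷ ε) ≡ suc (length ε)
fwd-after-ascent g δ e ε w asc
  rewrite fwd-∷ g (δ ++ e ∷ ε) | weaklyDecreasing-++ g δ (e ∷ ε) | >⇒≤ᵇ≡false (<ᵇ≡true⇒< (lastOr g δ) e asc)
        | BP.∧-zeroʳ (weaklyDecreasing (g ∷ δ)) with δ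
... | []     = fwd-weaklyDecreasing (e ∷ ε) w
... | z ∷ δ′ = fwd-after-ascent z δ′ e ε w asc

fwd-after-non-ascent : ∀ g δ e ε → weaklyDecreasing (e ∷ ε) ≡ true → (lastOr g δ <ᵇ e) ≡ false →
                       suc (length ε) < fwd (g ∷ δ ++ e ∷ ε)
fwd-after-non-ascent g δ e ε w nasc rewrite fwd-∷ g (δ ++ e ∷ ε) with weaklyDecreasing (g ∷ δ ++ e ∷ ε) in eq
... | true = s≤s (subst (suc (length ε) ≤_) (sym (LP.length-++ δ)) (ℕP.m≤n+m _ (length δ)))
fwd-after-non-ascent g [] e ε w nasc | false rewrite ≤⇒≤ᵇ≡true (<ᵇ≡false⇒≥ g e nasc) | w with eq
... | ()
fwd-after-non-ascent g (z ∷ δ) e ε w nasc | false = fwd-after-non-ascent z δ e ε w nasc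

fwd-map-suc : ∀ ρ → fwd (map suc ρ) ≡ fwd ρ
fwd-map-suc []      = refl
fwd-map-suc (x ∷ ρ)
  rewrite fwd-∷ (suc x) (map suc ρ) | fwd-∷ x ρ | fwd-map-suc ρ | LP.length-map suc ρ =
  cong (λ b → if b then suc (length ρ) else fwd ρ) (weaklyDecreasing-map-suc (x ∷ ρ))

headLe-zeros : ∀ j l → headLe (replicate j 0) l ≡ true
headLe-zeros zero    l = refl
headLe-zeros (suc j) l = refl

fwd-++-zeros : ∀ t τ j → fwd (t ∷ τ ++ replicate j 0) ≡ fwd (t ∷ τ) ℕ.+ j
fwd-++-zeros t τ j
  rewrite fwd-∷ t (τ ++ replicate j 0) | fwd-∷ t τ | weaklyDecreasing-++ t τ (replicate j 0)
        | headLe-zeros j (lastOr t τ) | weaklyDecreasing-zeros j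
        | BP.∧-identityʳ (weaklyDecreasing (t ∷ τ)) with weaklyDecreasing (t ∷ τ) in eq
... | true  = cong suc (trans (LP.length-++ τ) (cong (length τ ℕ.+_) (LP.length-replicate j)))
... | false with τ
... | []     with eq
... | ()
fwd-++-zeros t τ j | false | u ∷ τ′ = fwd-++-zeros u τ′ j

-- The pattern 0012

Has0012 : List ℕ → Set
Has0012 π = ∃ λ a → ∃ λ c → ∃ λ d → a ∷ a ∷ c ∷ d ∷ [] ⊆ π × a < c × c < d

subseqs⁺ : ∀ {σ π} → σ ⊆ π → σ ∈ subseqs (length σ) π
subseqs⁺ []                   = here refl
subseqs⁺ {[]}    (y ∷ʳ p)     = here refl
subseqs⁺ {_ ∷ _} (y ∷ʳ p)     = ∈-++⁺ʳ (map (y ∷_) _) (subseqs⁺ p)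
subseqs⁺         (refl ∷ p)   = ∈-++⁺ˡ (∈-map⁺ (_ ∷_) (subseqs⁺ p))

subseqs⁻ : ∀ k π {σ} → σ ∈ subseqs k π → σ ⊆ π
subseqs⁻ zero    π       (here refl) = minimum π
subseqs⁻ (suc k) (x ∷ π) σ∈ with ∈-++⁻ (map (x ∷_) (subseqs k π)) σ∈
... | inj₁ σ∈map with ∈-map⁻ (x ∷_) σ∈map
...   | σ′ , σ′∈ , refl = refl ∷ subseqs⁻ k π σ′∈
subseqs⁻ (suc k) (x ∷ π) σ∈ | inj₂ σ∈rest = x ∷ʳ subseqs⁻ (suc k) π σ∈rest

-- comparesLike and pairedWith0012 are, definitionally, the pieces of orderIso σ pat0012 for a
-- four-letter σ, so that AllP.all⁺ can take that conjunction apart.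
comparesLike : ℕ → ℕ → ℕ × ℕ → Bool
comparesLike a c (b , d) = cmp a b ≡ᵇ cmp c d

pairedWith0012 : ℕ → ℕ → ℕ → ℕ → List (ℕ × ℕ)
pairedWith0012 a b c d = (a , 0) ∷ (b , 0) ∷ (c , 1) ∷ (d , 2) ∷ []

cmp≡1⇒≡ : ∀ a b → T (cmp a b ≡ᵇ 1) → a ≡ b
cmp≡1⇒≡ a b h with a <ᵇ b | a ≡ᵇ b in e
... | false | true = ≡ᵇ≡true⇒≡ a b e

cmp≡0⇒< : ∀ a b → T (cmp a b ≡ᵇ 0) → a < b
cmp≡0⇒< a b h with a <ᵇ b in e | a ≡ᵇ b
... | true  | _     = <ᵇ≡true⇒< a b e
... | false | true  = ⊥-elim h
... | false | false = ⊥-elim h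

orderIso-0012⁻ : ∀ σ → T (orderIso σ pat0012) →
                 ∃ λ a → ∃ λ c → ∃ λ d → σ ≡ a ∷ a ∷ c ∷ d ∷ [] × a < c × c < d
orderIso-0012⁻ (a ∷ b ∷ c ∷ d ∷ []) h
  with AllP.all⁺ (λ (x , y) → all (comparesLike x y) (pairedWith0012 a b c d)) (pairedWith0012 a b c d) h
... | row-a ∷ _ ∷ row-c ∷ _
  with AllP.all⁺ (comparesLike a 0) (pairedWith0012 a b c d) row-a
     | AllP.all⁺ (comparesLike c 1) (pairedWith0012 a b c d) row-c
... | _ ∷ ab ∷ ac ∷ _ | _ ∷ _ ∷ _ ∷ cd ∷ [] =
  a , c , d , cong (λ x → a ∷ x ∷ c ∷ d ∷ []) (sym (cmp≡1⇒≡ a b ab)) , cmp≡0⇒< a c ac , cmp≡0⇒< c d cd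

cmp-refl : ∀ a → cmp a a ≡ 1
cmp-refl a rewrite ≥⇒<ᵇ≡false (ℕP.≤-refl {a}) | ≡ᵇ-refl a = refl

cmp-< : ∀ {a b} → a < b → cmp a b ≡ 0
cmp-< a<b rewrite <⇒<ᵇ≡true a<b = refl

cmp-> : ∀ {a b} → b < a → cmp a b ≡ 2
cmp-> b<a rewrite ≥⇒<ᵇ≡false (ℕP.<⇒≤ b<a) | >⇒≡ᵇ≡false b<a = refl

orderIso-0012⁺ : ∀ {a c d} → a < c → c < d → T (orderIso (a ∷ a ∷ c ∷ d ∷ []) pat0012)
orderIso-0012⁺ {a} {c} {d} a<c c<d
  rewrite cmp-refl a | cmp-refl c | cmp-refl d | cmp-< a<c | cmp-< c<d | cmp-< (ℕP.<-trans a<c c<d)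
        | cmp-> a<c | cmp-> c<d | cmp-> (ℕP.<-trans a<c c<d) = _

contains⇒Has0012 : ∀ π → contains π pat0012 ≡ true → Has0012 π
contains⇒Has0012 π h with find (AnyP.any⁻ (λ σ → orderIso σ pat0012) (subseqs 4 π) (≡true⇒T h))
... | σ , σ∈ , iso with orderIso-0012⁻ σ iso
... | a , c , d , refl , a<c , c<d = a , c , d , subseqs⁻ 4 π σ∈ , a<c , c<d

Has0012⇒contains : ∀ π → Has0012 π → contains π pat0012 ≡ true
Has0012⇒contains π (a , c , d , p , a<c , c<d) =
  T⇒≡true (AnyP.any⁺ (λ σ → orderIso σ pat0012) (lose (subseqs⁺ p) (orderIso-0012⁺ a<c c<d)))

contains-cong : ∀ π π′ → (Has0012 π → Has0012 π′) → (Has0012 π′ → Has0012 π) →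
                contains π pat0012 ≡ contains π′ pat0012
contains-cong π π′ to from with contains π pat0012 in e | contains π′ pat0012 in e′
... | true  | true  = refl
... | false | false = refl
... | true  | false = trans (sym (Has0012⇒contains π′ (to (contains⇒Has0012 π e)))) e′
... | false | true  = trans (sym e) (Has0012⇒contains π (from (contains⇒Has0012 π′ e′)))

⊆-++⁻ : ∀ (α β : List ℕ) {σ} → σ ⊆ α ++ β →
        ∃₂ λ σ₁ σ₂ → σ ≡ σ₁ ++ σ₂ × σ₁ ⊆ α × σ₂ ⊆ β
⊆-++⁻ []      β p            = [] , _ , refl , [] , p
⊆-++⁻ (a ∷ α) β (.a ∷ʳ p) with ⊆-++⁻ α β p
... | σ₁ , σ₂ , e , p₁ , p₂ = σ₁ , σ₂ , e , a ∷ʳ p₁ , p₂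
⊆-++⁻ (a ∷ α) β (refl ∷ p) with ⊆-++⁻ α β p
... | σ₁ , σ₂ , e , p₁ , p₂ = a ∷ σ₁ , σ₂ , cong (a ∷_) e , refl ∷ p₁ , p₂

⊆-map-suc⁻ : ∀ ρ {σ} → σ ⊆ map suc ρ → ∃ λ σ′ → σ ≡ map suc σ′ × σ′ ⊆ ρ
⊆-map-suc⁻ []      []           = [] , refl , []
⊆-map-suc⁻ (r ∷ ρ) (._ ∷ʳ p) with ⊆-map-suc⁻ ρ p
... | σ′ , e , q = σ′ , e , r ∷ʳ q
⊆-map-suc⁻ (r ∷ ρ) (refl ∷ p) with ⊆-map-suc⁻ ρ p
... | σ′ , e , q = r ∷ σ′ , cong (suc r ∷_) e , refl ∷ q

∈-weaklyDecreasing : ∀ {d} c ys → weaklyDecreasing (c ∷ ys) ≡ true → d ∈ ys → d ≤ c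
∈-weaklyDecreasing c (y ∷ ys) w d∈ with ∧≡true⇒ (y ≤ᵇ c) _ w
∈-weaklyDecreasing c (y ∷ ys) w (here refl) | y≤c , _  = ≤ᵇ≡true⇒≤ y c y≤c
∈-weaklyDecreasing c (y ∷ ys) w (there d∈)  | y≤c , w′ =
  ℕP.≤-trans (∈-weaklyDecreasing y ys w′ d∈) (≤ᵇ≡true⇒≤ y c y≤c)

⊆-weaklyDecreasing : ∀ {c d σ} β → weaklyDecreasing β ≡ true → c ∷ d ∷ σ ⊆ β → d ≤ c
⊆-weaklyDecreasing (y ∷ β) w (.y ∷ʳ p) = ⊆-weaklyDecreasing β (weaklyDecreasing-tail y β w) p
⊆-weaklyDecreasing (c ∷ β) w (refl ∷ p) = ∈-weaklyDecreasing c β w (lookup p (here refl))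

⊆-zeros : ∀ j {σ} → σ ⊆ replicate j 0 → allZero σ ≡ true
⊆-zeros zero    []           = refl
⊆-zeros (suc j) (._ ∷ʳ p)    = ⊆-zeros j p
⊆-zeros (suc j) (refl ∷ p)   = ⊆-zeros j p

0∈-¬zeroFree : ∀ α → zeroFree α ≡ false → 0 ∈ α
0∈-¬zeroFree (zero  ∷ α) e = here refl
0∈-¬zeroFree (suc x ∷ α) e = there (0∈-¬zeroFree α e)

contains-drop0 : ∀ γ β → weaklyDecreasing β ≡ true →
                 contains (γ ++ 0 ∷ β) pat0012 ≡ contains (γ ++ β) pat0012
contains-drop0 γ β w = contains-cong _ _ drop insert
  where
  -- An occurrence using the inserted 0 has c = 0, d = 0, or c and d in the weakly decreasing β.
  drop : Has0012 (γ ++ 0 ∷ β) → Has0012 (γ ++ β)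
  drop (a , c , d , p , a<c , c<d) with ⊆-++⁻ γ (0 ∷ β) p
  ... | σ₁ , σ₂ , e , p₁ , ._ ∷ʳ p₂ = a , c , d , subst (_⊆ γ ++ β) (sym e) (++⁺ p₁ p₂) , a<c , c<d
  ... | []                 , _ , refl , _ , refl ∷ p₂ = ⊥-elim (ℕP.<⇒≱ c<d (⊆-weaklyDecreasing β w (∷ˡ⁻ p₂)))
  ... | _ ∷ []             , _ , refl , _ , refl ∷ p₂ = ⊥-elim (ℕP.<⇒≱ c<d (⊆-weaklyDecreasing β w p₂))
  ... | _ ∷ _ ∷ []         , _ , refl , _ , refl ∷ p₂ = ⊥-elim (ℕP.n≮0 a<c)
  ... | _ ∷ _ ∷ _ ∷ []     , _ , refl , _ , refl ∷ p₂ = ⊥-elim (ℕP.n≮0 c<d)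
  ... | _ ∷ _ ∷ _ ∷ _ ∷ []    , _ , ()   , _ , refl ∷ p₂
  ... | _ ∷ _ ∷ _ ∷ _ ∷ _ ∷ _ , _ , ()   , _ , refl ∷ p₂
  insert : Has0012 (γ ++ β) → Has0012 (γ ++ 0 ∷ β)
  insert (a , c , d , p , a<c , c<d) with ⊆-++⁻ γ β p
  ... | σ₁ , σ₂ , e , p₁ , p₂ = a , c , d , subst (_⊆ γ ++ 0 ∷ β) (sym e) (++⁺ p₁ (0 ∷ʳ p₂)) , a<c , c<d

contains-0∷map-suc : ∀ ρ → contains (0 ∷ map suc ρ) pat0012 ≡ contains ρ pat0012
contains-0∷map-suc ρ = contains-cong _ _ unshift shift
  where
  unshift : Has0012 (0 ∷ map suc ρ) → Has0012 ρ
  unshift (a , c , d , ._ ∷ʳ p , a<c , c<d) with ⊆-map-suc⁻ ρ p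
  unshift (suc a , suc c , suc d , ._ ∷ʳ p , a<c , c<d) | _ ∷ _ ∷ _ ∷ _ ∷ [] , refl , q =
    a , c , d , q , ℕP.≤-pred a<c , ℕP.≤-pred c<d
  unshift (zero , c , d , refl ∷ p , a<c , c<d) with ⊆-map-suc⁻ ρ p
  ... | [] , () , _
  ... | _ ∷ _ , () , _
  shift : Has0012 ρ → Has0012 (0 ∷ map suc ρ)
  shift (a , c , d , p , a<c , c<d) = suc a , suc c , suc d , 0 ∷ʳ map⁺ suc p , s≤s a<c , s≤s c<d

contains-++-zeros : ∀ τ j → contains (τ ++ replicate j 0) pat0012 ≡ contains τ pat0012
contains-++-zeros τ j = contains-cong _ _ drop append
  where
  drop : Has0012 (τ ++ replicate j 0) → Has0012 τ
  drop (a , c , d , p , a<c , c<d) with ⊆-++⁻ τ (replicate j 0) p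
  ... | σ₁ , [] , e , p₁ , _ = a , c , d , subst (_⊆ τ) (sym (trans e (LP.++-identityʳ σ₁))) p₁ , a<c , c<d
  ... | σ₁ , s ∷ σ₂ , e , _ , p₂ = ⊥-elim (ℕP.n≮0 (subst (c <_) d≡0 c<d))
    where
    d≡0 : d ≡ 0
    d≡0 = trans (cong (lastOr 0) e) (trans (lastOr-++ 0 σ₁ s σ₂) (allZero⇒lastOr≡0 s σ₂ (⊆-zeros j p₂)))
  append : Has0012 τ → Has0012 (τ ++ replicate j 0)
  append (a , c , d , p , a<c , c<d) =
    a , c , d , subst (_⊆ τ ++ replicate j 0) (LP.++-identityʳ _) (++⁺ p (minimum _)) , a<c , c<d

contains-rise-after-two-zeros : ∀ α y b β → zeroFree α ≡ false → suc y < b →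
                                contains (0 ∷ α ++ suc y ∷ b ∷ β) pat0012 ≡ true
contains-rise-after-two-zeros α y b β z y<b = Has0012⇒contains _
  (0 , suc y , b , refl ∷ ++⁺ (from∈ (0∈-¬zeroFree α z)) (refl ∷ refl ∷ minimum β) , s≤s z≤n , y<b)

-- B as a sum of weights

admissible : ℕ → List ℕ → Bool
admissible m π = isAscentSeq π ∧ (avoids π pat0012 ∧ (not (endsInZero π) ∧ (asc π ≡ᵇ m)))

weight : ℕ → ℤ → ℤ → List ℕ → ℤ
weight m u v π = 𝟙 (admissible m π) * u ^ fwd π * v ^ zeros π

weight-≡0 : ∀ m u v π → admissible m π ≡ false → weight m u v π ≡ + 0
weight-≡0 m u v π adm rewrite adm = trans (cong (_* v ^ zeros π) (ℤP.*-zeroˡ (u ^ fwd π))) (ℤP.*-zeroˡ (v ^ zeros π))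

weight-suc∷ : ∀ m u v y σ → weight m u v (suc y ∷ σ) ≡ + 0
weight-suc∷ m u v y σ = weight-≡0 m u v (suc y ∷ σ) refl

admissible-notAscentSeq : ∀ m π → isAscentSeq π ≡ false → admissible m π ≡ false
admissible-notAscentSeq m π e rewrite e = refl

admissible-contains : ∀ m π → contains π pat0012 ≡ true → admissible m π ≡ false
admissible-contains m π c rewrite c = BP.∧-zeroʳ (isAscentSeq π)

admissible-endsInZero : ∀ m π → endsInZero π ≡ true → admissible m π ≡ false
admissible-endsInZero m π e rewrite e | BP.∧-zeroʳ (avoids π pat0012) = BP.∧-zeroʳ (isAscentSeq π)

admissible-asc : ∀ m π → (asc π ≡ᵇ m) ≡ false → admissible m π ≡ false
admissible-asc m π e
  rewrite e | BP.∧-zeroʳ (not (endsInZero π)) | BP.∧-zeroʳ (avoids π pat0012) = BP.∧-zeroʳ (isAscentSeq π)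

length-filter : ∀ (p : List ℕ → Bool) xs → + length (filter (λ x → T? (p x)) xs) ≡ ∑ xs (λ x → 𝟙 (p x))
length-filter p []       = refl
length-filter p (x ∷ xs) with p x
... | true  = cong (_+_ (+ 1)) (length-filter p xs)
... | false = trans (length-filter p xs) (sym (ℤP.+-identityˡ _))

∑-filter : ∀ (p : List ℕ → Bool) xs (f : List ℕ → ℤ) →
           ∑ (filter (λ x → T? (p x)) xs) f ≡ ∑ xs (λ x → 𝟙 (p x) * f x)
∑-filter p []       f = refl
∑-filter p (x ∷ xs) f with p x
... | true  = cong₂ _+_ (sym (ℤP.*-identityˡ (f x))) (∑-filter p xs f)
... | false = sym (trans (cong₂ _+_ (ℤP.*-zeroˡ (f x)) (sym (∑-filter p xs f))) (ℤP.+-identityˡ _))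

statistics : ℕ → ℕ → ℕ → List ℕ → Bool
statistics m r ℓ π = avoids π pat0012 ∧ not (endsInZero π) ∧ (asc π ≡ᵇ m) ∧ (zeros π ≡ᵇ r) ∧ (fwd π ≡ᵇ ℓ)

b≡∑ : ∀ n m r ℓ → + b n m r ℓ ≡ ∑ (lists n n) (λ π → 𝟙 (isAscentSeq π) * 𝟙 (statistics m r ℓ π))
b≡∑ n m r ℓ =
  trans (length-filter (statistics m r ℓ) (ascentSeqs n)) (∑-filter isAscentSeq (lists n n) _)

𝟙-statistics : ∀ m r ℓ π →
  𝟙 (isAscentSeq π) * 𝟙 (statistics m r ℓ π) ≡ 𝟙 (admissible m π) * 𝟙 (zeros π ≡ᵇ r) * 𝟙 (fwd π ≡ᵇ ℓ)
𝟙-statistics m r ℓ π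
  rewrite 𝟙-∧ (avoids π pat0012) (not (endsInZero π) ∧ (asc π ≡ᵇ m) ∧ (zeros π ≡ᵇ r) ∧ (fwd π ≡ᵇ ℓ))
        | 𝟙-∧ (not (endsInZero π)) ((asc π ≡ᵇ m) ∧ (zeros π ≡ᵇ r) ∧ (fwd π ≡ᵇ ℓ))
        | 𝟙-∧ (asc π ≡ᵇ m) ((zeros π ≡ᵇ r) ∧ (fwd π ≡ᵇ ℓ))
        | 𝟙-∧ (zeros π ≡ᵇ r) (fwd π ≡ᵇ ℓ)
        | 𝟙-∧ (isAscentSeq π) (avoids π pat0012 ∧ not (endsInZero π) ∧ (asc π ≡ᵇ m))
        | 𝟙-∧ (avoids π pat0012) (not (endsInZero π) ∧ (asc π ≡ᵇ m))
        | 𝟙-∧ (not (endsInZero π)) (asc π ≡ᵇ m) =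
  regroup (𝟙 (isAscentSeq π)) (𝟙 (avoids π pat0012)) (𝟙 (not (endsInZero π))) (𝟙 (asc π ≡ᵇ m))
          (𝟙 (zeros π ≡ᵇ r)) (𝟙 (fwd π ≡ᵇ ℓ))
  where
  regroup : ∀ a p q s z f → a * (p * (q * (s * (z * f)))) ≡ a * (p * (q * s)) * z * f
  regroup = solve-∀

∑∑-select : ∀ n c (z f : ℕ) u v → (c ≡ true → 1 ≤ z × z ≤ n × 1 ≤ f × f ≤ n) →
  ∑ (range 1 n) (λ r → ∑ (range 1 n) (λ ℓ → 𝟙 c * 𝟙 (z ≡ᵇ r) * 𝟙 (f ≡ᵇ ℓ) * u ^ ℓ * v ^ r))
  ≡ 𝟙 c * u ^ f * v ^ z
∑∑-select n false z f u v _ =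
  trans (∑-zero (range 1 n) (λ r → ∑-zero (range 1 n) (λ ℓ →
           vanish (𝟙 (z ≡ᵇ r)) (𝟙 (f ≡ᵇ ℓ)) (u ^ ℓ) (v ^ r))))
        (sym (trans (cong (_* v ^ z) (ℤP.*-zeroˡ (u ^ f))) (ℤP.*-zeroˡ (v ^ z))))
  where
  vanish : ∀ a b x y → + 0 * a * b * x * y ≡ + 0
  vanish = solve-∀
∑∑-select n true z f u v bounds with bounds refl
... | 1≤z , z≤len , 1≤f , f≤len = begin
  ∑ (range 1 n) (λ r → ∑ (range 1 n) (λ ℓ → + 1 * 𝟙 (z ≡ᵇ r) * 𝟙 (f ≡ᵇ ℓ) * u ^ ℓ * v ^ r))
    ≡⟨ ∑-cong (range 1 n) (λ r →
         trans (∑-cong (range 1 n) (λ ℓ → reassoc (𝟙 (z ≡ᵇ r)) (𝟙 (f ≡ᵇ ℓ)) (u ^ ℓ) (v ^ r)))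
               (∑-*ˡ (range 1 n) (𝟙 (z ≡ᵇ r)) _)) ⟩
  ∑ (range 1 n) (λ r → 𝟙 (z ≡ᵇ r) * ∑ (range 1 n) (λ ℓ → 𝟙 (f ≡ᵇ ℓ) * (u ^ ℓ * v ^ r)))
    ≡⟨ ∑-cong (range 1 n) (λ r →
         cong (𝟙 (z ≡ᵇ r) *_) (∑-range-select 1 n f (λ ℓ → u ^ ℓ * v ^ r) 1≤f (s≤s f≤len))) ⟩
  ∑ (range 1 n) (λ r → 𝟙 (z ≡ᵇ r) * (u ^ f * v ^ r))
    ≡⟨ ∑-range-select 1 n z (λ r → u ^ f * v ^ r) 1≤z (s≤s z≤len) ⟩
  u ^ f * v ^ z
    ≡⟨ sym (trans (ℤP.*-assoc (+ 1) (u ^ f) (v ^ z)) (ℤP.*-identityˡ _)) ⟩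
  + 1 * u ^ f * v ^ z ∎
  where
  reassoc : ∀ a b x y → + 1 * a * b * x * y ≡ a * (b * (x * y))
  reassoc = solve-∀

admissible-bounds : ∀ n m π → length π ≡ n → 1 ≤ m → admissible m π ≡ true →
                    1 ≤ zeros π × zeros π ≤ n × 1 ≤ fwd π × fwd π ≤ n
admissible-bounds n (suc m) []      len  _ ()
admissible-bounds n m       (x ∷ π) refl _ adm =
  zeros-positive x π (proj₁ (∧≡true⇒ _ _ adm)) , zeros≤length (x ∷ π) , fwd-positive x π , fwd≤length (x ∷ π)

B≡∑weight : ∀ n m u v → 1 ≤ m → B n m u v ≡ ∑ (lists n n) (weight m u v)
B≡∑weight n m u v 1≤m = begin
  B n m u v
    ≡⟨ sumFrom≡∑range 1 n _ ⟩
  ∑ (range 1 n) (λ r → sumFrom 1 n (λ ℓ → + b n m r ℓ * u ^ ℓ * v ^ r))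
    ≡⟨ ∑-cong (range 1 n) (λ r → trans (sumFrom≡∑range 1 n _) (∑-cong (range 1 n) (λ ℓ → count r ℓ))) ⟩
  ∑ (range 1 n) (λ r → ∑ (range 1 n) (λ ℓ → ∑ (lists n n) (λ π → I r ℓ π * u ^ ℓ * v ^ r)))
    ≡⟨ ∑-cong (range 1 n) (λ r → ∑-comm (range 1 n) (lists n n) _) ⟩
  ∑ (range 1 n) (λ r → ∑ (lists n n) (λ π → ∑ (range 1 n) (λ ℓ → I r ℓ π * u ^ ℓ * v ^ r)))
    ≡⟨ ∑-comm (range 1 n) (lists n n) _ ⟩
  ∑ (lists n n) (λ π → ∑ (range 1 n) (λ r → ∑ (range 1 n) (λ ℓ → I r ℓ π * u ^ ℓ * v ^ r)))
    ≡⟨ ∑-lists-cong n n (λ π len → trans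
         (∑-cong (range 1 n) (λ r → ∑-cong (range 1 n) (λ ℓ →
            cong (λ x → x * u ^ ℓ * v ^ r) (𝟙-statistics m r ℓ π))))
         (∑∑-select n (admissible m π) (zeros π) (fwd π) u v (admissible-bounds n m π len 1≤m))) ⟩
  ∑ (lists n n) (weight m u v) ∎
  where
  I : ℕ → ℕ → List ℕ → ℤ
  I r ℓ π = 𝟙 (isAscentSeq π) * 𝟙 (statistics m r ℓ π)
  count : ∀ r ℓ → + b n m r ℓ * u ^ ℓ * v ^ r ≡ ∑ (lists n n) (λ π → I r ℓ π * u ^ ℓ * v ^ r)
  count r ℓ = begin
    + b n m r ℓ * u ^ ℓ * v ^ r                     ≡⟨ cong (λ x → x * u ^ ℓ * v ^ r) (b≡∑ n m r ℓ) ⟩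
    ∑ (lists n n) (I r ℓ) * u ^ ℓ * v ^ r           ≡⟨ ℤP.*-assoc (∑ (lists n n) (I r ℓ)) (u ^ ℓ) (v ^ r) ⟩
    ∑ (lists n n) (I r ℓ) * (u ^ ℓ * v ^ r)         ≡⟨ ∑-*ʳ (lists n n) (u ^ ℓ * v ^ r) (I r ℓ) ⟨
    ∑ (lists n n) (λ π → I r ℓ π * (u ^ ℓ * v ^ r)) ≡⟨ ∑-cong (lists n n) (λ π → sym (ℤP.*-assoc (I r ℓ π) (u ^ ℓ) (v ^ r))) ⟩
    ∑ (lists n n) (λ π → I r ℓ π * u ^ ℓ * v ^ r)   ∎

hasEntry≥-mono : ∀ {k k′} r → k ≤ k′ → hasEntry≥ k r ≡ false → hasEntry≥ k′ r ≡ false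
hasEntry≥-mono         []      k≤k′ h = refl
hasEntry≥-mono {k} {k′} (x ∷ r) k≤k′ h with k ≤ᵇ x in e
... | false rewrite >⇒≤ᵇ≡false (ℕP.<-≤-trans (≤ᵇ≡false⇒> k x e) k≤k′) = hasEntry≥-mono r k≤k′ h

ascentStep≤ : ∀ (c : Bool) a n → (if c then suc a else a) ℕ.+ n ≤ a ℕ.+ suc n
ascentStep≤ true  a n = ℕP.≤-reflexive (sym (ℕP.+-suc a n))
ascentStep≤ false a n = ℕP.+-monoʳ-≤ a (ℕP.n≤1+n n)

validAfter⇒bounded : ∀ a l r → validAfter a l r ≡ true → hasEntry≥ (suc (a ℕ.+ length r)) r ≡ false
validAfter⇒bounded a l []      h = refl
validAfter⇒bounded a l (x ∷ r) h with ∧≡true⇒ (x ≤ᵇ suc a) _ h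
... | x≤1+a , rest = cong₂ _∨_ head-small tail-small
  where
  head-small : (suc (a ℕ.+ suc (length r)) ≤ᵇ x) ≡ false
  head-small = >⇒≤ᵇ≡false (s≤s (ℕP.≤-trans (≤ᵇ≡true⇒≤ x (suc a) x≤1+a)
                 (subst (suc a ≤_) (sym (ℕP.+-suc a (length r))) (s≤s (ℕP.m≤m+n a (length r))))))
  tail-small : hasEntry≥ (suc (a ℕ.+ suc (length r))) r ≡ false
  tail-small = hasEntry≥-mono r (s≤s (ascentStep≤ (l <ᵇ x) a (length r))) (validAfter⇒bounded _ x r rest)

isAscentSeq⇒bounded : ∀ π → isAscentSeq π ≡ true → hasEntry≥ (length π) π ≡ false
isAscentSeq⇒bounded []          h = refl
isAscentSeq⇒bounded (zero ∷ r)  h = validAfter⇒bounded 0 0 r (trans (sym (isAscentSeq-0∷ r)) h)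

weight-bounded : ∀ m u v π → hasEntry≥ (length π) π ≡ true → weight m u v π ≡ + 0
weight-bounded m u v π big = weight-≡0 m u v π (admissible-notAscentSeq m π not-ascentSeq)
  where
  not-ascentSeq : isAscentSeq π ≡ false
  not-ascentSeq with isAscentSeq π in a
  ... | false = refl
  ... | true  with trans (sym big) (isAscentSeq⇒bounded π a)
  ... | ()

∑weight-restrict : ∀ l {N} m u v → l ≤ N → ∑ (lists l N) (weight m u v) ≡ ∑ (lists l l) (weight m u v)
∑weight-restrict l m u v l≤N =
  ∑-lists-restrict l l≤N (weight m u v) (λ xs len big →
    weight-bounded m u v xs (subst (λ k → hasEntry≥ k xs ≡ true) (sym len) big))

B≡∑weight-wide : ∀ n m u v → 1 ≤ m → B n m u v ≡ ∑ (lists n (suc n)) (weight m u v)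
B≡∑weight-wide n m u v 1≤m = trans (B≡∑weight n m u v 1≤m) (sym (∑weight-restrict n m u v (ℕP.n≤1+n n)))

B-short : ∀ k m u v → 1 ≤ m → k ≤ m → B k m u v ≡ + 0
B-short k m u v 1≤m k≤m =
  trans (B≡∑weight k m u v 1≤m)
  (trans (∑-lists-cong k k (λ π len →
            weight-≡0 m u v π (admissible-asc m π (few-ascents π (subst (_≤ m) (sym len) k≤m)))))
         (∑-zero (lists k k) (λ _ → refl)))
  where
  few-ascents : ∀ π → length π ≤ m → (asc π ≡ᵇ m) ≡ false
  few-ascents []      _   = <⇒≡ᵇ≡false 1≤m
  few-ascents (x ∷ π) len = <⇒≡ᵇ≡false (ℕP.<-≤-trans (s≤s (asc<length x π)) len)

-- Deleting a zero

admissible-cong : ∀ π σ m m′ → isAscentSeq π ≡ isAscentSeq σ → contains π pat0012 ≡ contains σ pat0012 →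
                  endsInZero π ≡ endsInZero σ → (asc π ≡ᵇ m) ≡ (asc σ ≡ᵇ m′) → admissible m π ≡ admissible m′ σ
admissible-cong π σ m m′ a p e s = cong₂ _∧_ a (cong₂ _∧_ (cong not p) (cong₂ _∧_ (cong not e) s))

weight-extraZero : ∀ π σ m u v → admissible m π ≡ admissible m σ → fwd π ≡ fwd σ → zeros π ≡ suc (zeros σ) →
                   weight m u v π ≡ v * weight m u v σ
weight-extraZero π σ m u v adm f z rewrite adm | f | z = reassoc (𝟙 (admissible m σ)) (u ^ fwd σ) v (v ^ zeros σ)
  where
  reassoc : ∀ a b v c → a * b * (v * c) ≡ v * (a * b * c)
  reassoc = solve-∀

weight-extraZeroAscent : ∀ π σ m u v → admissible (suc m) π ≡ admissible m σ → zeros π ≡ suc (zeros σ) →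
                         weight (suc m) u v π ≡ v * (u ^ fwd π * weight m (+ 1) v σ)
weight-extraZeroAscent π σ m u v adm z rewrite adm | z | ℤP.^-zeroˡ (fwd σ) =
  reassoc (𝟙 (admissible m σ)) (u ^ fwd π) v (v ^ zeros σ)
  where
  reassoc : ∀ a b v c → a * b * (v * c) ≡ v * (b * (a * + 1 * c))
  reassoc = solve-∀

insert-as-prefix : ∀ α x β → 0 ∷ α ++ x ∷ β ≡ 0 ∷ (α ++ [ x ]) ++ β
insert-as-prefix α x β = cong (0 ∷_) (sym (LP.++-assoc α [ x ] β))

fwd-insert-nonDecr : ∀ α x β → weaklyDecreasing β ≡ false → fwd (0 ∷ α ++ x ∷ β) ≡ fwd β
fwd-insert-nonDecr α x β w = trans (cong fwd (insert-as-prefix α x β)) (fwd-++ʳ (0 ∷ α ++ [ x ]) β w)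

fwd-insert-ascent : ∀ α x e ε → weaklyDecreasing (e ∷ ε) ≡ true → (x <ᵇ e) ≡ true →
                    fwd (0 ∷ α ++ x ∷ e ∷ ε) ≡ suc (length ε)
fwd-insert-ascent α x e ε w x<e = trans (cong fwd (insert-as-prefix α x (e ∷ ε)))
  (fwd-after-ascent 0 (α ++ [ x ]) e ε w (trans (cong (_<ᵇ e) (lastOr-++ 0 α x [])) x<e))

fwd-insert-noAscent : ∀ α x e ε → weaklyDecreasing (e ∷ ε) ≡ true → (x <ᵇ e) ≡ false →
                      suc (length ε) < fwd (0 ∷ α ++ x ∷ e ∷ ε)
fwd-insert-noAscent α x e ε w x≮e = subst (suc (length ε) <_) (sym (cong fwd (insert-as-prefix α x (e ∷ ε))))
  (fwd-after-non-ascent 0 (α ++ [ x ]) e ε w (trans (cong (_<ᵇ e) (lastOr-++ 0 α x [])) x≮e))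

endsInZero-insert : ∀ α x e ε → endsInZero (0 ∷ α ++ x ∷ e ∷ ε) ≡ endsIn0 (e ∷ ε)
endsInZero-insert α x e ε = trans (endsInZero≡endsIn0 (0 ∷ α ++ x ∷ e ∷ ε)) (cong (_≡ᵇ 0) (lastOr-++ 0 α x (e ∷ ε)))

endsInZero-middle : ∀ α e ε → endsInZero (0 ∷ α ++ e ∷ ε) ≡ endsIn0 (e ∷ ε)
endsInZero-middle α e ε = trans (endsInZero≡endsIn0 (0 ∷ α ++ e ∷ ε)) (cong (_≡ᵇ 0) (lastOr-++ 0 α e ε))

weight-positive-before-run : ∀ m u v α y β →
  𝟙 (fwd (0 ∷ α ++ suc y ∷ β) ≡ᵇ length β)
    * (𝟙 (not (zeroFree (α ++ suc y ∷ β))) * weight m u v (0 ∷ α ++ suc y ∷ β)) ≡ + 0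
weight-positive-before-run m u v α y []      = 𝟙-false _ (>⇒≡ᵇ≡false (fwd-positive 0 (α ++ [ suc y ])))
weight-positive-before-run m u v α y (b ∷ β) = by-run (weaklyDecreasing (b ∷ β)) refl
  where
  π = 0 ∷ α ++ suc y ∷ b ∷ β
  I = 𝟙 (not (zeroFree (α ++ suc y ∷ b ∷ β)))
  X = I * weight m u v π
  by-run : ∀ c → weaklyDecreasing (b ∷ β) ≡ c → 𝟙 (fwd π ≡ᵇ suc (length β)) * X ≡ + 0
  by-run false w = 𝟙-false X (<⇒≡ᵇ≡false (subst (_< suc (length β)) (sym (fwd-insert-nonDecr α (suc y) (b ∷ β) w))
                                                  (fwd<length (b ∷ β) w)))
  by-run true  w with suc y <ᵇ b in y<b
  ... | false = 𝟙-false X (>⇒≡ᵇ≡false (fwd-insert-noAscent α (suc y) b β w y<b))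
  ... | true  = trans (𝟙-true X (trans (cong (_≡ᵇ suc (length β)) (fwd-insert-ascent α (suc y) b β w y<b))
                                      (≡ᵇ-refl (suc (length β)))))
                      vanishes
    where
    vanishes : X ≡ + 0
    vanishes with endsIn0 (b ∷ β) in ez | zeroFree α in zα
    ... | true  | _     = trans (cong (I *_) (weight-≡0 m u v π
                                  (admissible-endsInZero m π (trans (endsInZero-insert α (suc y) b β) ez))))
                                (ℤP.*-zeroʳ I)
    ... | false | true  = 𝟙-false (weight m u v π) (cong not (trans (zeroFree-++ α (suc y ∷ b ∷ β))
                                      (cong₂ _∧_ zα (weaklyDecreasing⇒zeroFree (b ∷ β) w ez))))
    ... | false | false = trans (cong (I *_) (weight-≡0 m u v π (admissible-contains m π
                                  (contains-rise-after-two-zeros α y b β zα (<ᵇ≡true⇒< (suc y) b y<b)))))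
                                (ℤP.*-zeroʳ I)

validAfter-weaklyDecreasing : ∀ a b β → weaklyDecreasing (b ∷ β) ≡ true → b ≤ suc a → validAfter a b β ≡ true
validAfter-weaklyDecreasing a b []      w b≤1+a = refl
validAfter-weaklyDecreasing a b (y ∷ β) w b≤1+a with ∧≡true⇒ (y ≤ᵇ b) _ w
... | y≤b , w′
  rewrite ≤⇒≤ᵇ≡true (ℕP.≤-trans (≤ᵇ≡true⇒≤ y b y≤b) b≤1+a) | ≥⇒<ᵇ≡false (≤ᵇ≡true⇒≤ y b y≤b) =
  validAfter-weaklyDecreasing a y β w′ (ℕP.≤-trans (≤ᵇ≡true⇒≤ y b y≤b) b≤1+a)

isAscentSeq-drop0 : ∀ α b β → weaklyDecreasing (suc b ∷ β) ≡ true →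
                    isAscentSeq (0 ∷ α ++ 0 ∷ suc b ∷ β) ≡ isAscentSeq (0 ∷ α ++ suc b ∷ β)
isAscentSeq-drop0 α b β w
  rewrite isAscentSeq-0∷ (α ++ 0 ∷ suc b ∷ β) | isAscentSeq-0∷ (α ++ suc b ∷ β)
        | validAfter-++ 0 0 α (0 ∷ suc b ∷ β) | validAfter-++ 0 0 α (suc b ∷ β) =
  cong (validAfter 0 0 α ∧_) (after-prefix (ascAfter 0 0 α) (lastOr 0 α))
  where
  -- With or without the 0, the entries of β are at most suc b ≤ suc a, so the ascent count is irrelevant.
  after-prefix : ∀ a l → validAfter a l (0 ∷ suc b ∷ β) ≡ validAfter a l (suc b ∷ β)
  after-prefix a l with l <ᵇ suc b
  ... | true  = refl
  ... | false with suc b ≤ᵇ suc a in b≤a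
  ...   | false = refl
  ...   | true  = trans (validAfter-weaklyDecreasing (suc a) (suc b) β w (ℕP.m≤n⇒m≤1+n 1+b≤1+a))
                        (sym (validAfter-weaklyDecreasing a (suc b) β w 1+b≤1+a))
    where 1+b≤1+a = ≤ᵇ≡true⇒≤ (suc b) (suc a) b≤a

asc-with-0 : ∀ α b β → asc (0 ∷ α ++ 0 ∷ suc b ∷ β) ≡ asc (0 ∷ α) ℕ.+ suc (asc (suc b ∷ β))
asc-with-0 α b β =
  trans (asc-++ 0 α (0 ∷ suc b ∷ β)) (cong (ℕ._+ suc (asc (suc b ∷ β))) (ℕP.+-identityʳ (asc (0 ∷ α))))

zeros-drop0 : ∀ α β → zeros (0 ∷ α ++ 0 ∷ β) ≡ suc (zeros (0 ∷ α ++ β))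
zeros-drop0 α β =
  cong suc (trans (zeros-++ α (0 ∷ β)) (trans (ℕP.+-suc (zeros α) (zeros β)) (cong suc (sym (zeros-++ α β)))))

-- π₀ b is σ b with a 0 inserted just before b ∷ β, which is the final run of π₀ b when it is counted.
module DropZero (m : ℕ) (u v : ℤ) (α β : List ℕ) where

  k : ℕ
  k = suc (length β)

  π₀ σ : ℕ → List ℕ
  π₀ b = 0 ∷ α ++ 0 ∷ b ∷ β
  σ  b = 0 ∷ α ++ b ∷ β

  withZero withoutZero : ℕ → ℤ
  withZero    b = 𝟙 (fwd (π₀ b) ≡ᵇ k) * weight (suc m) u v (π₀ b)
  withoutZero b = v * (𝟙 (fwd (σ b) ≡ᵇ k) * weight (suc m) u v (σ b))
                + v * (u ^ k * (𝟙 (k <ᵇ fwd (σ b)) * weight m (+ 1) v (σ b)))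

  private
    both-vanish : ∀ {c c′} W Q → c ≡ false → c′ ≡ false → v * (𝟙 c * W) + v * (u ^ k * (𝟙 c′ * Q)) ≡ + 0
    both-vanish W Q refl refl = vanish v (u ^ k) W Q
      where
      vanish : ∀ v a W Q → v * (+ 0 * W) + v * (a * (+ 0 * Q)) ≡ + 0
      vanish = solve-∀

  not-decreasing : ∀ b → weaklyDecreasing (b ∷ β) ≡ false → withZero b ≡ withoutZero b
  not-decreasing b w =
    trans (𝟙-false _ (<⇒≡ᵇ≡false (subst (_< k) (sym (fwd-insert-nonDecr α 0 (b ∷ β) w)) (fwd<length (b ∷ β) w))))
    (sym (both-vanish _ _ (<⇒≡ᵇ≡false (subst (_< k) (sym fwdσ) (fwd<length (b ∷ β) w)))
                          (≥⇒<ᵇ≡false (subst (_≤ k) (sym fwdσ) (fwd≤length (b ∷ β))))))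
    where
    fwdσ : fwd (σ b) ≡ fwd (b ∷ β)
    fwdσ = fwd-++ʳ (0 ∷ α) (b ∷ β) w

  ends-in-zero : weaklyDecreasing (0 ∷ β) ≡ true → withZero 0 ≡ withoutZero 0
  ends-in-zero w =
    trans (𝟙-false _ (>⇒≡ᵇ≡false (fwd-insert-noAscent α 0 0 β w refl)))
    (sym (trans (cong₂ (λ W Q → v * (𝟙 (fwd (σ 0) ≡ᵇ k) * W) + v * (u ^ k * (𝟙 (k <ᵇ fwd (σ 0)) * Q)))
                       (weight-≡0 (suc m) u v (σ 0) (admissible-endsInZero (suc m) (σ 0) σ-ends-in-0))
                       (weight-≡0 m (+ 1) v (σ 0) (admissible-endsInZero m (σ 0) σ-ends-in-0)))
                (vanish v (u ^ k) (𝟙 (fwd (σ 0) ≡ᵇ k)) (𝟙 (k <ᵇ fwd (σ 0))))))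
    where
    σ-ends-in-0 : endsInZero (σ 0) ≡ true
    σ-ends-in-0 = trans (endsInZero-middle α 0 β) (weaklyDecreasing⇒endsIn0 (0 ∷ β) w refl)
    vanish : ∀ v a c c′ → v * (c * + 0) + v * (a * (c′ * + 0)) ≡ + 0
    vanish = solve-∀

  module _ (b : ℕ) (w : weaklyDecreasing (suc b ∷ β) ≡ true) where

    private
      π′ σ′ : List ℕ
      π′ = π₀ (suc b)
      σ′ = σ (suc b)

      W Q : ℤ
      W = weight (suc m) u v σ′
      Q = weight m (+ 1) v σ′

      fwdπ′ : fwd π′ ≡ k
      fwdπ′ = fwd-insert-ascent α 0 (suc b) β w refl

      withZero≡weight : withZero (suc b) ≡ weight (suc m) u v π′
      withZero≡weight = 𝟙-true _ (trans (cong (_≡ᵇ k) fwdπ′) (≡ᵇ-refl k))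

      withoutZero≡ : ∀ {c c′} → (fwd σ′ ≡ᵇ k) ≡ c → (k <ᵇ fwd σ′) ≡ c′ →
                     withoutZero (suc b) ≡ v * (𝟙 c * W) + v * (u ^ k * (𝟙 c′ * Q))
      withoutZero≡ e e′ = cong₂ (λ c c′ → v * (𝟙 c * W) + v * (u ^ k * (𝟙 c′ * Q))) e e′

      admissible-drop0 : ∀ m m′ → (asc π′ ≡ᵇ m) ≡ (asc σ′ ≡ᵇ m′) → admissible m π′ ≡ admissible m′ σ′
      admissible-drop0 m m′ =
        admissible-cong π′ σ′ m m′ (isAscentSeq-drop0 α b β w) (contains-drop0 (0 ∷ α) (suc b ∷ β) w)
          (trans (endsInZero-insert α 0 (suc b) β) (sym (endsInZero-middle α (suc b) β)))

      asc-σ′ : asc σ′ ≡ asc (0 ∷ α) ℕ.+ (if lastOr 0 α <ᵇ suc b then 1 else 0) ℕ.+ asc (suc b ∷ β)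
      asc-σ′ = asc-++ 0 α (suc b ∷ β)

    keeps-ascent : (lastOr 0 α <ᵇ suc b) ≡ true → withZero (suc b) ≡ withoutZero (suc b)
    keeps-ascent a<b = begin
      withZero (suc b)
        ≡⟨ withZero≡weight ⟩
      weight (suc m) u v π′
        ≡⟨ weight-extraZero π′ σ′ (suc m) u v (admissible-drop0 (suc m) (suc m) (cong (_≡ᵇ suc m) same-asc))
                            (trans fwdπ′ (sym fwdσ′)) (zeros-drop0 α (suc b ∷ β)) ⟩
      v * W
        ≡⟨ tidy v (u ^ k) W Q ⟩
      v * (𝟙 true * W) + v * (u ^ k * (𝟙 false * Q))
        ≡⟨ withoutZero≡ (trans (cong (_≡ᵇ k) fwdσ′) (≡ᵇ-refl k))
                        (trans (cong (k <ᵇ_) fwdσ′) (≥⇒<ᵇ≡false (ℕP.≤-refl {k}))) ⟨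
      withoutZero (suc b) ∎
      where
      fwdσ′ : fwd σ′ ≡ k
      fwdσ′ = fwd-after-ascent 0 α (suc b) β w a<b
      same-asc : asc π′ ≡ asc σ′
      same-asc = trans (asc-with-0 α b β)
                 (trans (sym (ℕP.+-assoc (asc (0 ∷ α)) 1 _))
                 (sym (trans asc-σ′ (cong (λ c → asc (0 ∷ α) ℕ.+ (if c then 1 else 0) ℕ.+ asc (suc b ∷ β)) a<b))))
      tidy : ∀ v a W Q → v * W ≡ v * (+ 1 * W) + v * (a * (+ 0 * Q))
      tidy = solve-∀

    loses-ascent : (lastOr 0 α <ᵇ suc b) ≡ false → withZero (suc b) ≡ withoutZero (suc b)
    loses-ascent a≮b = begin
      withZero (suc b)
        ≡⟨ withZero≡weight ⟩
      weight (suc m) u v π′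
        ≡⟨ weight-extraZeroAscent π′ σ′ m u v (admissible-drop0 (suc m) m (cong (_≡ᵇ suc m) one-more-asc))
                                  (zeros-drop0 α (suc b ∷ β)) ⟩
      v * (u ^ fwd π′ * Q)
        ≡⟨ cong (λ f → v * (u ^ f * Q)) fwdπ′ ⟩
      v * (u ^ k * Q)
        ≡⟨ tidy v (u ^ k) W Q ⟩
      v * (𝟙 false * W) + v * (u ^ k * (𝟙 true * Q))
        ≡⟨ withoutZero≡ (>⇒≡ᵇ≡false k<fwdσ′) (<⇒<ᵇ≡true k<fwdσ′) ⟨
      withoutZero (suc b) ∎
      where
      k<fwdσ′ : k < fwd σ′
      k<fwdσ′ = fwd-after-non-ascent 0 α (suc b) β w a≮b
      one-more-asc : asc π′ ≡ suc (asc σ′)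
      one-more-asc = trans (asc-with-0 α b β)
                     (trans (ℕP.+-suc (asc (0 ∷ α)) _)
                     (cong suc (sym (trans asc-σ′
                       (trans (cong (λ c → asc (0 ∷ α) ℕ.+ (if c then 1 else 0) ℕ.+ asc (suc b ∷ β)) a≮b)
                              (cong (ℕ._+ asc (suc b ∷ β)) (ℕP.+-identityʳ (asc (0 ∷ α)))))))))
      tidy : ∀ v a W Q → v * (a * Q) ≡ v * (+ 0 * W) + v * (a * (+ 1 * Q))
      tidy = solve-∀

  weight-drop0 : ∀ b → withZero b ≡ withoutZero b
  weight-drop0 b with weaklyDecreasing (b ∷ β) in w
  weight-drop0 b       | false = not-decreasing b w
  weight-drop0 zero    | true  = ends-in-zero w
  weight-drop0 (suc b) | true  with lastOr 0 α <ᵇ suc b in a<b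
  ... | true  = keeps-ascent b w a<b
  ... | false = loses-ascent b w a<b

-- Sequences with a second zero

weight-weaklyDecreasing : ∀ m u v π → weaklyDecreasing π ≡ true → weight (suc m) u v π ≡ + 0
weight-weaklyDecreasing m u v π w =
  weight-≡0 (suc m) u v π (admissible-asc (suc m) π (cong (_≡ᵇ suc m) (weaklyDecreasing⇒asc≡0 π w)))

fwd-0∷ : ∀ σ → weaklyDecreasing (0 ∷ σ) ≡ false → fwd (0 ∷ σ) ≡ fwd σ
fwd-0∷ σ w = trans (fwd-∷ 0 σ) (cong (λ c → if c then suc (length σ) else fwd σ) w)

weight-long-run : ∀ m u v σ → length σ ≤ fwd (0 ∷ σ) →
                  𝟙 (not (zeroFree σ)) * weight (suc m) u v (0 ∷ σ) ≡ + 0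
weight-long-run m u v σ long with weaklyDecreasing (0 ∷ σ) in w₀
... | true  = trans (cong (𝟙 (not (zeroFree σ)) *_) (weight-weaklyDecreasing m u v (0 ∷ σ) w₀))
                    (ℤP.*-zeroʳ (𝟙 (not (zeroFree σ))))
... | false with weaklyDecreasing σ in w
...   | false = ⊥-elim (ℕP.<⇒≱ (fwd<length σ w) (subst (length σ ≤_) (fwd-0∷ σ w₀) long))
...   | true  with zeroFree σ in z
...     | true  = ℤP.*-zeroˡ (weight (suc m) u v (0 ∷ σ))
...     | false = trans (ℤP.*-identityˡ _) (weight-≡0 (suc m) u v (0 ∷ σ) (admissible-endsInZero (suc m) (0 ∷ σ)
                    (trans (endsInZero≡endsIn0 (0 ∷ σ)) (endsIn0-∷ 0 σ (weaklyDecreasing⇒endsIn0 σ w z)))))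

weight-run-too-long : ∀ m u v σ → length σ < fwd (0 ∷ σ) → weight (suc m) u v (0 ∷ σ) ≡ + 0
weight-run-too-long m u v σ long with weaklyDecreasing (0 ∷ σ) in w₀
... | true  = weight-weaklyDecreasing m u v (0 ∷ σ) w₀
... | false = ⊥-elim (ℕP.<⇒≱ long (subst (_≤ length σ) (sym (fwd-0∷ σ w₀)) (fwd≤length σ)))

∑-linear₂ : {A : Set} (xs : List A) (v a : ℤ) (f g : A → ℤ) →
            ∑ xs (λ x → v * f x + v * (a * g x)) ≡ v * ∑ xs f + v * (a * ∑ xs g)
∑-linear₂ xs v a f g =
  trans (∑-+ xs _ _) (cong₂ _+_ (∑-*ˡ xs v f) (trans (∑-*ˡ xs v _) (cong (v *_) (∑-*ˡ xs a g))))

∑-lists-0∷-split : ∀ n k N (F : List ℕ → ℤ) → k ≤ n → (∀ y σ → F (suc y ∷ σ) ≡ + 0) →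
  ∑ (lists (suc n) (suc N)) F ≡ ∑ (lists (n ∸ k) (suc N)) (λ α → ∑ (lists k (suc N)) (λ β → F (0 ∷ α ++ β)))
∑-lists-0∷-split n k N F k≤n vanish =
  trans (∑-lists-head0 n N F vanish) (∑-lists-split (n ∸ k) k (suc N) (λ σ → F (0 ∷ σ)) (ℕP.m∸n+n≡m k≤n))

-- (u B(1,v) - B(u,v))/(1 - u), expanded as ∑_σ ∑_{1≤k<fwd σ} u^k v^(zeros σ) so that nothing is divided.
ΔB : ℕ → ℕ → ℤ → ℤ → ℤ
ΔB m n u v =
  ∑ (lists n (suc n)) (λ σ → ∑ (range 1 (n ∸ 1)) (λ k → u ^ k * (𝟙 (k <ᵇ fwd σ) * weight m (+ 1) v σ)))

ΔB-split : ∀ m n u v → ΔB m (suc n) u v ≡ ∑ (range 1 n) (λ k → u ^ k *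
  ∑ (lists (n ∸ k) (suc (suc n))) (λ α → ∑ (lists k (suc (suc n))) (λ β →
    𝟙 (k <ᵇ fwd (0 ∷ α ++ β)) * weight m (+ 1) v (0 ∷ α ++ β))))
ΔB-split m n u v =
  trans (∑-comm (lists (suc n) (suc (suc n))) (range 1 n) _)
  (∑-range-cong 1 n (λ k _ k<1+n → trans (∑-*ˡ (lists (suc n) (suc (suc n))) (u ^ k) _)
    (cong (u ^ k *_) (∑-lists-0∷-split n k (suc n) _ (ℕP.≤-pred k<1+n)
      (λ y σ → trans (cong (𝟙 (k <ᵇ fwd (suc y ∷ σ)) *_) (weight-suc∷ m (+ 1) v y σ))
                     (ℤP.*-zeroʳ (𝟙 (k <ᵇ fwd (suc y ∷ σ)))))))))

∑-runs-after-0 : ∀ m n u v → ∑ (range 1 n) (λ k → ∑ (lists (n ∸ k) (suc (suc n))) (λ α →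
  ∑ (lists k (suc (suc n))) (λ β → 𝟙 (fwd (0 ∷ α ++ β) ≡ᵇ k) * weight (suc m) u v (0 ∷ α ++ β))))
  ≡ ∑ (lists (suc n) (suc (suc n))) (weight (suc m) u v)
∑-runs-after-0 m n u v = sym (begin
  ∑ (lists (suc n) N) W
    ≡⟨ ∑-lists-head0 n (suc n) W (weight-suc∷ (suc m) u v) ⟩
  ∑ (lists n N) (λ σ → W (0 ∷ σ))
    ≡⟨ ∑-lists-by-suffix n N (λ σ → fwd (0 ∷ σ)) (λ σ → W (0 ∷ σ))
         (λ σ len long → weight-run-too-long m u v σ (subst (_< fwd (0 ∷ σ)) (sym len) long)) ⟩
  ∑ (range 0 (suc n)) run-of-length
    ≡⟨ cong (_+ runs) (∑-zero (lists n N) (λ α → trans (ℤP.+-identityʳ _)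
                      (𝟙-false _ (>⇒≡ᵇ≡false (fwd-positive 0 (α ++ [])))))) ⟩
  + 0 + runs
    ≡⟨ ℤP.+-identityˡ runs ⟩
  runs ∎)
  where
  N = suc (suc n)
  W = weight (suc m) u v
  run-of-length : ℕ → ℤ
  run-of-length k = ∑ (lists (n ∸ k) N) (λ α → ∑ (lists k N) (λ β → 𝟙 (fwd (0 ∷ α ++ β) ≡ᵇ k) * W (0 ∷ α ++ β)))
  runs = ∑ (range 1 n) run-of-length

drop0-summand : ∀ m u v α k β → length β ≡ k → 1 ≤ k →
  𝟙 (fwd (0 ∷ α ++ 0 ∷ β) ≡ᵇ k) * (𝟙 (not (zeroFree (α ++ 0 ∷ β))) * weight (suc m) u v (0 ∷ α ++ 0 ∷ β))
  ≡ v * (𝟙 (fwd (0 ∷ α ++ β) ≡ᵇ k) * weight (suc m) u v (0 ∷ α ++ β))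
    + v * (u ^ k * (𝟙 (k <ᵇ fwd (0 ∷ α ++ β)) * weight m (+ 1) v (0 ∷ α ++ β)))
drop0-summand m u v α .(suc (length β)) (b ∷ β) refl _ =
  trans (cong (λ z → I * (𝟙 (not z) * W))
              (trans (zeroFree-++ α (0 ∷ b ∷ β)) (BP.∧-zeroʳ (zeroFree α))))
  (trans (cong (I *_) (ℤP.*-identityˡ W)) (DropZero.weight-drop0 m u v α β b))
  where
  I = 𝟙 (fwd (0 ∷ α ++ 0 ∷ b ∷ β) ≡ᵇ suc (length β))
  W = weight (suc m) u v (0 ∷ α ++ 0 ∷ b ∷ β)

∑-with-second-zero : ∀ m n u v →
  ∑ (lists (suc n) (suc (suc n))) (λ σ → 𝟙 (not (zeroFree σ)) * weight (suc m) u v (0 ∷ σ))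
  ≡ v * ∑ (lists (suc n) (suc (suc n))) (weight (suc m) u v) + v * ΔB m (suc n) u v
∑-with-second-zero m n u v = begin
  ∑ (lists (suc n) N) G
    ≡⟨ ∑-lists-by-marked-suffix (suc n) N (λ σ → fwd (0 ∷ σ)) G
         (λ σ len long → weight-long-run m u v σ (subst (_≤ fwd (0 ∷ σ)) (sym len) long)) ⟩
  ∑ (range 0 (suc n)) (λ k → ∑ (lists (n ∸ k) N) (λ α → ∑ (upTo N) (λ x → ∑ (lists k N) (λ β → marked k α x β))))
    ≡⟨ ∑-cong (range 0 (suc n)) (λ k → ∑-cong (lists (n ∸ k) N) (λ α → only-zero-marks k α)) ⟩
  ∑ (range 0 (suc n)) (λ k → ∑ (lists (n ∸ k) N) (λ α → ∑ (lists k N) (λ β → marked k α 0 β)))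
    ≡⟨ cong (_+ ∑ (range 1 n) zero-marked) (∑-zero (lists n N) (λ α → trans (ℤP.+-identityʳ _)
          (𝟙-false _ (>⇒≡ᵇ≡false (fwd-positive 0 (α ++ 0 ∷ [])))))) ⟩
  + 0 + ∑ (range 1 n) zero-marked
    ≡⟨ ℤP.+-identityˡ _ ⟩
  ∑ (range 1 n) (λ k → ∑ (lists (n ∸ k) N) (λ α → ∑ (lists k N) (λ β → marked k α 0 β)))
    ≡⟨ ∑-range-cong 1 n (λ k 1≤k _ → trans
         (∑-cong (lists (n ∸ k) N) (λ α → trans (∑-lists-cong k N (λ β len → drop0-summand m u v α k β len 1≤k))
                                                (∑-linear₂ (lists k N) v (u ^ k) _ _)))
         (∑-linear₂ (lists (n ∸ k) N) v (u ^ k) _ _)) ⟩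
  ∑ (range 1 n) (λ k → v * runs k + v * (u ^ k * longer k))
    ≡⟨ trans (∑-+ (range 1 n) _ _) (cong₂ _+_ (∑-*ˡ (range 1 n) v runs) (∑-*ˡ (range 1 n) v _)) ⟩
  v * ∑ (range 1 n) runs + v * ∑ (range 1 n) (λ k → u ^ k * longer k)
    ≡⟨ cong₂ (λ x y → v * x + v * y) (∑-runs-after-0 m n u v) (sym (ΔB-split m n u v)) ⟩
  v * ∑ (lists (suc n) N) (weight (suc m) u v) + v * ΔB m (suc n) u v ∎
  where
  N = suc (suc n)
  G : List ℕ → ℤ
  G σ = 𝟙 (not (zeroFree σ)) * weight (suc m) u v (0 ∷ σ)
  marked : ℕ → List ℕ → ℕ → List ℕ → ℤ
  marked k α x β = 𝟙 (fwd (0 ∷ α ++ x ∷ β) ≡ᵇ k) * G (α ++ x ∷ β)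
  zero-marked runs longer : ℕ → ℤ
  zero-marked k = ∑ (lists (n ∸ k) N) (λ α → ∑ (lists k N) (marked k α 0))
  runs k = ∑ (lists (n ∸ k) N) (λ α → ∑ (lists k N) (λ β →
             𝟙 (fwd (0 ∷ α ++ β) ≡ᵇ k) * weight (suc m) u v (0 ∷ α ++ β)))
  longer k = ∑ (lists (n ∸ k) N) (λ α → ∑ (lists k N) (λ β →
               𝟙 (k <ᵇ fwd (0 ∷ α ++ β)) * weight m (+ 1) v (0 ∷ α ++ β)))
  only-zero-marks : ∀ k α → ∑ (upTo N) (λ x → ∑ (lists k N) (marked k α x)) ≡ ∑ (lists k N) (marked k α 0)
  only-zero-marks k α =
    trans (∑-comm (upTo N) (lists k N) (marked k α))
    (∑-lists-cong k N (λ β len → ∑-upTo-head (suc n) (λ x → marked k α x β)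
      (λ y → subst (λ k′ → marked k′ α (suc y) β ≡ + 0) len (weight-positive-before-run (suc m) u v α y β))))

-- Sequences with a single zero

endFreeWeight : ℕ → ℤ → List ℕ → ℤ
endFreeWeight m u ρ = 𝟙 (isAscentSeq ρ ∧ (avoids ρ pat0012 ∧ (asc ρ ≡ᵇ m))) * u ^ fwd ρ

endFreeWeight-asc : ∀ m u ρ → (asc ρ ≡ᵇ m) ≡ false → endFreeWeight m u ρ ≡ + 0
endFreeWeight-asc m u ρ e
  rewrite e | BP.∧-zeroʳ (avoids ρ pat0012) | BP.∧-zeroʳ (isAscentSeq ρ) = ℤP.*-zeroˡ (u ^ fwd ρ)

isAscentSeq-0∷map-suc : ∀ r ρ → isAscentSeq (0 ∷ map suc (r ∷ ρ)) ≡ isAscentSeq (r ∷ ρ)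
isAscentSeq-0∷map-suc zero    ρ =
  trans (isAscentSeq-0∷ (1 ∷ map suc ρ)) (trans (validAfter-map-suc 0 0 ρ) (sym (isAscentSeq-0∷ ρ)))
isAscentSeq-0∷map-suc (suc r) ρ = isAscentSeq-0∷ (suc (suc r) ∷ map suc ρ)

weight-0∷map-suc : ∀ m u v r ρ → weight (suc m) u v (0 ∷ map suc (r ∷ ρ)) ≡ v * endFreeWeight m u (r ∷ ρ)
weight-0∷map-suc m u v r ρ = begin
  𝟙 (admissible (suc m) π) * u ^ fwd π * v ^ zeros π
    ≡⟨ cong₂ (λ c f → 𝟙 c * u ^ f * v ^ zeros π) same-data same-fwd ⟩
  𝟙 C * u ^ fwd (r ∷ ρ) * v ^ suc (zeros (map suc (r ∷ ρ)))
    ≡⟨ cong (λ z → 𝟙 C * u ^ fwd (r ∷ ρ) * v ^ suc z) (zeros-map-suc (r ∷ ρ)) ⟩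
  𝟙 C * u ^ fwd (r ∷ ρ) * v ^ 1
    ≡⟨ reassoc (𝟙 C) (u ^ fwd (r ∷ ρ)) v ⟩
  v * (𝟙 C * u ^ fwd (r ∷ ρ)) ∎
  where
  π = 0 ∷ map suc (r ∷ ρ)
  C = isAscentSeq (r ∷ ρ) ∧ (avoids (r ∷ ρ) pat0012 ∧ (asc (r ∷ ρ) ≡ᵇ m))
  same-data : admissible (suc m) π ≡ C
  same-data = cong₂ _∧_ (isAscentSeq-0∷map-suc r ρ) (cong₂ _∧_ (cong not (contains-0∷map-suc (r ∷ ρ)))
                (cong₂ _∧_ (cong not (trans (endsInZero≡endsIn0 π) (cong (_≡ᵇ 0) (lastOr-map-suc r ρ))))
                           (cong (_≡ᵇ m) (asc-map-suc (r ∷ ρ)))))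
  same-fwd : fwd π ≡ fwd (r ∷ ρ)
  same-fwd = trans (fwd-∷ 0 (map suc (r ∷ ρ))) (fwd-map-suc (r ∷ ρ))
  reassoc : ∀ a b v → a * b * (v * + 1) ≡ v * (a * b)
  reassoc = solve-∀

isAscentSeq-++-zeros : ∀ τ j → isAscentSeq (τ ++ replicate j 0) ≡ isAscentSeq τ
isAscentSeq-++-zeros []          zero    = refl
isAscentSeq-++-zeros []          (suc j) = trans (isAscentSeq-0∷ (replicate j 0)) (validAfter-zeros 0 0 j)
isAscentSeq-++-zeros (zero  ∷ τ) j = begin
  isAscentSeq (0 ∷ τ ++ replicate j 0)                         ≡⟨ isAscentSeq-0∷ (τ ++ replicate j 0) ⟩
  validAfter 0 0 (τ ++ replicate j 0)                          ≡⟨ validAfter-++ 0 0 τ (replicate j 0) ⟩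
  validAfter 0 0 τ ∧ validAfter _ _ (replicate j 0)            ≡⟨ cong (validAfter 0 0 τ ∧_) (validAfter-zeros _ _ j) ⟩
  validAfter 0 0 τ ∧ true                                      ≡⟨ BP.∧-identityʳ _ ⟩
  validAfter 0 0 τ                                             ≡⟨ isAscentSeq-0∷ τ ⟨
  isAscentSeq (0 ∷ τ)                                          ∎
isAscentSeq-++-zeros (suc t ∷ τ) j = refl

asc-++-zeros : ∀ t τ j → asc (t ∷ τ ++ replicate j 0) ≡ asc (t ∷ τ)
asc-++-zeros t τ j =
  trans (asc-++ t τ (replicate j 0))
  (trans (cong₂ (λ a b → asc (t ∷ τ) ℕ.+ a ℕ.+ b) (no-ascent-into-zeros (lastOr t τ) j) (asc-zeros j))
  (trans (ℕP.+-identityʳ _) (ℕP.+-identityʳ _)))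
  where
  no-ascent-into-zeros : ∀ l j → ascentAt l (replicate j 0) ≡ 0
  no-ascent-into-zeros l zero    = refl
  no-ascent-into-zeros l (suc j) = refl

endFreeWeight-++-zeros : ∀ m u τ j → 1 ≤ m →
                         𝟙 (not (endsIn0 τ)) * endFreeWeight m u (τ ++ replicate j 0) ≡ u ^ j * weight m u (+ 1) τ
endFreeWeight-++-zeros (suc m) u [] j _ =
  trans (ℤP.*-identityˡ _) (trans (endFreeWeight-asc (suc m) u (replicate j 0) (cong (_≡ᵇ suc m) (asc-zeros j)))
                                  (sym (ℤP.*-zeroʳ (u ^ j))))
endFreeWeight-++-zeros m u (t ∷ τ) j _ with endsIn0 (t ∷ τ) in ez
... | true  = trans (ℤP.*-zeroˡ (endFreeWeight m u (t ∷ τ ++ replicate j 0))) (sym (trans (cong (u ^ j *_)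
                (weight-≡0 m u (+ 1) (t ∷ τ) (admissible-endsInZero m (t ∷ τ) (trans (endsInZero≡endsIn0 (t ∷ τ)) ez))))
                (ℤP.*-zeroʳ (u ^ j))))
... | false = begin
  + 1 * endFreeWeight m u (t ∷ τ ++ replicate j 0)
    ≡⟨ ℤP.*-identityˡ _ ⟩
  𝟙 (isAscentSeq (t ∷ τ ++ replicate j 0) ∧ (avoids (t ∷ τ ++ replicate j 0) pat0012 ∧ (asc (t ∷ τ ++ replicate j 0) ≡ᵇ m)))
    * u ^ fwd (t ∷ τ ++ replicate j 0)
    ≡⟨ cong₂ (λ c f → 𝟙 c * u ^ f)
         (cong₂ _∧_ (isAscentSeq-++-zeros (t ∷ τ) j)
                    (cong₂ _∧_ (cong not (contains-++-zeros (t ∷ τ) j)) (cong (_≡ᵇ m) (asc-++-zeros t τ j))))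
         (fwd-++-zeros t τ j) ⟩
  𝟙 C * u ^ (fwd (t ∷ τ) ℕ.+ j)
    ≡⟨ cong (𝟙 C *_) (ℤP.^-distribˡ-+-* u (fwd (t ∷ τ)) j) ⟩
  𝟙 C * (u ^ fwd (t ∷ τ) * u ^ j)
    ≡⟨ reassoc (𝟙 C) (u ^ fwd (t ∷ τ)) (u ^ j) ⟩
  u ^ j * (𝟙 C * u ^ fwd (t ∷ τ) * + 1)
    ≡⟨ cong₂ (λ c z → u ^ j * (𝟙 c * u ^ fwd (t ∷ τ) * z)) same-data (sym (ℤP.^-zeroˡ (zeros (t ∷ τ)))) ⟩
  u ^ j * weight m u (+ 1) (t ∷ τ) ∎
  where
  C = isAscentSeq (t ∷ τ) ∧ (avoids (t ∷ τ) pat0012 ∧ (asc (t ∷ τ) ≡ᵇ m))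
  same-data : C ≡ admissible m (t ∷ τ)
  same-data = cong (λ e → isAscentSeq (t ∷ τ) ∧ (avoids (t ∷ τ) pat0012 ∧ (not e ∧ (asc (t ∷ τ) ≡ᵇ m))))
                   (sym (trans (endsInZero≡endsIn0 (t ∷ τ)) ez))
  reassoc : ∀ c a b → c * (a * b) ≡ b * (c * a * + 1)
  reassoc = solve-∀

trailingZeros : List ℕ → ℕ
trailingZeros []       = 0
trailingZeros (x ∷ xs) = if allZero (x ∷ xs) then suc (length xs) else trailingZeros xs

trailingZeros≤length : ∀ xs → trailingZeros xs ≤ length xs
trailingZeros≤length []       = z≤n
trailingZeros≤length (x ∷ xs) with allZero (x ∷ xs)
... | true  = ℕP.≤-refl
... | false = ℕP.m≤n⇒m≤1+n (trailingZeros≤length xs)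

trailingZeros≡length : ∀ β → (trailingZeros β ≡ᵇ length β) ≡ allZero β
trailingZeros≡length []       = refl
trailingZeros≡length (x ∷ xs) with allZero (x ∷ xs)
... | true  = ≡ᵇ-refl (length xs)
... | false = <⇒≡ᵇ≡false (s≤s (trailingZeros≤length xs))

trailingZeros-++ : ∀ τ β → (trailingZeros (τ ++ β) ≡ᵇ length β) ≡ allZero β ∧ not (endsIn0 τ)
trailingZeros-++ []      β = trans (trailingZeros≡length β) (sym (BP.∧-identityʳ (allZero β)))
trailingZeros-++ (t ∷ τ) β with allZero (t ∷ τ ++ β) in all0
... | true = trans (>⇒≡ᵇ≡false (s≤s (subst (length β ≤_) (sym (LP.length-++ τ)) (ℕP.m≤n+m _ _))))
                   (sym (trans (cong (λ c → allZero β ∧ not c) τ-ends-in-0) (BP.∧-zeroʳ (allZero β))))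
  where
  τ-ends-in-0 : endsIn0 (t ∷ τ) ≡ true
  τ-ends-in-0 = cong (_≡ᵇ 0) (allZero⇒lastOr≡0 t τ (proj₁ (∧≡true⇒ (allZero (t ∷ τ)) (allZero β)
                  (trans (sym (allZero-++ (t ∷ τ) β)) all0))))
... | false with τ
...   | s ∷ τ′ = trailingZeros-++ (s ∷ τ′) β
...   | []     = trans (trailingZeros≡length β) (last-entry t all0)
  where
  last-entry : ∀ t → allZero (t ∷ β) ≡ false → allZero β ≡ allZero β ∧ not (t ≡ᵇ 0)
  last-entry zero    e = trans e (sym (BP.∧-zeroʳ (allZero β)))
  last-entry (suc t) e = sym (BP.∧-identityʳ (allZero β))

∑-endFreeWeight-by-trailingZeros : ∀ m n u j → 1 ≤ m →
  ∑ (lists (suc n ∸ j) (suc n)) (λ τ → ∑ (lists j (suc n)) (λ β → 𝟙 (trailingZeros (τ ++ β) ≡ᵇ j) * endFreeWeight m u (τ ++ β)))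
  ≡ u ^ j * B (suc n ∸ j) m u (+ 1)
∑-endFreeWeight-by-trailingZeros m n u j 1≤m = begin
  ∑ (lists (suc n ∸ j) (suc n)) (λ τ → ∑ (lists j (suc n)) (λ β → 𝟙 (trailingZeros (τ ++ β) ≡ᵇ j) * V (τ ++ β)))
    ≡⟨ ∑-cong (lists (suc n ∸ j) (suc n)) (λ τ → trans (∑-lists-cong j (suc n) (λ β len → split-indicator τ β len))
                                              (∑-lists-allZero j n (λ β → 𝟙 (not (endsIn0 τ)) * V (τ ++ β)))) ⟩
  ∑ (lists (suc n ∸ j) (suc n)) (λ τ → 𝟙 (not (endsIn0 τ)) * V (τ ++ replicate j 0))
    ≡⟨ ∑-cong (lists (suc n ∸ j) (suc n)) (λ τ → endFreeWeight-++-zeros m u τ j 1≤m) ⟩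
  ∑ (lists (suc n ∸ j) (suc n)) (λ τ → u ^ j * weight m u (+ 1) τ)
    ≡⟨ ∑-*ˡ (lists (suc n ∸ j) (suc n)) (u ^ j) (weight m u (+ 1)) ⟩
  u ^ j * ∑ (lists (suc n ∸ j) (suc n)) (weight m u (+ 1))
    ≡⟨ cong (u ^ j *_) (trans (∑weight-restrict (suc n ∸ j) m u (+ 1) (ℕP.m∸n≤m (suc n) j))
                              (sym (B≡∑weight (suc n ∸ j) m u (+ 1) 1≤m))) ⟩
  u ^ j * B (suc n ∸ j) m u (+ 1) ∎
  where
  V = endFreeWeight m u
  split-indicator : ∀ τ β → length β ≡ j →
    𝟙 (trailingZeros (τ ++ β) ≡ᵇ j) * V (τ ++ β) ≡ 𝟙 (allZero β) * (𝟙 (not (endsIn0 τ)) * V (τ ++ β))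
  split-indicator τ β refl =
    trans (cong (λ c → 𝟙 c * V (τ ++ β)) (trailingZeros-++ τ β))
    (trans (cong (_* V (τ ++ β)) (𝟙-∧ (allZero β) (not (endsIn0 τ))))
           (ℤP.*-assoc (𝟙 (allZero β)) (𝟙 (not (endsIn0 τ))) (V (τ ++ β))))

∑-endFreeWeight : ∀ m n u → 1 ≤ m → m ≤ n →
  ∑ (lists (suc n) (suc n)) (endFreeWeight m u)
  ≡ sumFrom 0 (suc n ∸ m) (λ j → u ^ j * B (suc (suc n) ∸ j ∸ 1) m u (+ 1))
∑-endFreeWeight m n u 1≤m m≤n = begin
  ∑ (lists (suc n) (suc n)) (endFreeWeight m u)
    ≡⟨ ∑-lists-by-suffix (suc n) (suc n) trailingZeros (endFreeWeight m u)
         (λ σ len long → ⊥-elim (ℕP.<⇒≱ long (subst (trailingZeros σ ≤_) len (trailingZeros≤length σ)))) ⟩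
  ∑ (range 0 (suc (suc n))) (λ j → ∑ (lists (suc n ∸ j) (suc n)) (λ τ → ∑ (lists j (suc n)) (λ β →
      𝟙 (trailingZeros (τ ++ β) ≡ᵇ j) * endFreeWeight m u (τ ++ β))))
    ≡⟨ ∑-range-cong 0 (suc (suc n)) (λ j _ _ → ∑-endFreeWeight-by-trailingZeros m n u j 1≤m) ⟩
  ∑ (range 0 (suc (suc n))) f
    ≡⟨ cong (λ L → ∑ (range 0 L) f) split-point ⟨
  ∑ (range 0 (suc n ∸ m ℕ.+ suc m)) f
    ≡⟨ ∑-range-+ 0 (suc n ∸ m) (suc m) f ⟩
  ∑ (range 0 (suc n ∸ m)) f + ∑ (range (suc n ∸ m) (suc m)) f
    ≡⟨ cong (_+_ (∑ (range 0 (suc n ∸ m)) f)) too-short ⟩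
  ∑ (range 0 (suc n ∸ m)) f + + 0
    ≡⟨ ℤP.+-identityʳ _ ⟩
  ∑ (range 0 (suc n ∸ m)) f
    ≡⟨ ∑-range-cong 0 (suc n ∸ m) (λ j _ _ → cong (λ t → u ^ j * B t m u (+ 1)) (sym (suc-∸-∸1 (suc n) j))) ⟩
  ∑ (range 0 (suc n ∸ m)) (λ j → u ^ j * B (suc (suc n) ∸ j ∸ 1) m u (+ 1))
    ≡⟨ sumFrom≡∑range 0 (suc n ∸ m) _ ⟨
  sumFrom 0 (suc n ∸ m) (λ j → u ^ j * B (suc (suc n) ∸ j ∸ 1) m u (+ 1)) ∎
  where
  f : ℕ → ℤ
  f j = u ^ j * B (suc n ∸ j) m u (+ 1)
  split-point : suc n ∸ m ℕ.+ suc m ≡ suc (suc n)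
  split-point = trans (ℕP.+-suc (suc n ∸ m) m) (cong suc (ℕP.m∸n+n≡m (ℕP.m≤n⇒m≤1+n m≤n)))
  too-short : ∑ (range (suc n ∸ m) (suc m)) f ≡ + 0
  too-short = trans (∑-range-cong (suc n ∸ m) (suc m) {g = λ _ → + 0} (λ j n-m≤j _ →
                trans (cong (u ^ j *_) (B-short (suc n ∸ j) m u (+ 1) 1≤m
                        (ℕP.≤-trans (ℕP.∸-monoʳ-≤ (suc n) n-m≤j) (ℕP.≤-reflexive (ℕP.m∸[m∸n]≡n (ℕP.m≤n⇒m≤1+n m≤n))))))
                      (ℤP.*-zeroʳ (u ^ j))))
              (∑-zero (range (suc n ∸ m) (suc m)) (λ _ → refl))
  suc-∸-∸1 : ∀ n j → suc n ∸ j ∸ 1 ≡ n ∸ j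
  suc-∸-∸1 n       zero    = refl
  suc-∸-∸1 zero    (suc j) = cong (_∸ 1) (ℕP.0∸n≡0 j)
  suc-∸-∸1 (suc n) (suc j) = suc-∸-∸1 n j

-- The divided difference ΔB

geometric-sum : ∀ u lo K ℓ → lo ≤ ℓ → ℓ ≤ lo ℕ.+ K →
                (+ 1 - u) * ∑ (range lo K) (λ k → u ^ k * 𝟙 (k <ᵇ ℓ)) ≡ u ^ lo - u ^ ℓ
geometric-sum u lo zero    ℓ lo≤ℓ ℓ≤lo+0 rewrite ℕP.≤-antisym lo≤ℓ (subst (ℓ ≤_) (ℕP.+-identityʳ lo) ℓ≤lo+0) =
  trans (ℤP.*-zeroʳ (+ 1 - u)) (sym (ℤP.+-inverseʳ (u ^ ℓ)))
geometric-sum u lo (suc K) ℓ lo≤ℓ ℓ≤lo+K with ℕP.m≤n⇒m<n∨m≡n lo≤ℓ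
... | inj₂ refl = trans (cong ((+ 1 - u) *_) nothing-below) (trans (ℤP.*-zeroʳ (+ 1 - u)) (sym (ℤP.+-inverseʳ (u ^ lo))))
  where
  nothing-below : ∑ (range lo (suc K)) (λ k → u ^ k * 𝟙 (k <ᵇ lo)) ≡ + 0
  nothing-below = trans (∑-range-cong lo (suc K) {g = λ _ → + 0}
                          (λ k lo≤k _ → trans (cong (λ c → u ^ k * 𝟙 c) (≥⇒<ᵇ≡false lo≤k)) (ℤP.*-zeroʳ (u ^ k))))
                        (∑-zero (range lo (suc K)) (λ _ → refl))
... | inj₁ lo<ℓ rewrite <⇒<ᵇ≡true lo<ℓ =
  trans (distrib u (u ^ lo) _)
  (trans (cong (λ z → (+ 1 - u) * u ^ lo + z) (geometric-sum u (suc lo) K ℓ lo<ℓ (subst (ℓ ≤_) (ℕP.+-suc lo K) ℓ≤lo+K)))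
         (telescope u (u ^ lo) (u ^ ℓ)))
  where
  distrib : ∀ u p S → (+ 1 - u) * (p * + 1 + S) ≡ (+ 1 - u) * p + (+ 1 - u) * S
  distrib = solve-∀
  telescope : ∀ u p q → (+ 1 - u) * p + (u * p - q) ≡ p - q
  telescope = solve-∀

indicator-geometric : ∀ u (c : Bool) f z n → (c ≡ true → 1 ≤ f × f ≤ suc n) →
  u * (𝟙 c * (+ 1) ^ f * z) - 𝟙 c * u ^ f * z
  ≡ (+ 1 - u) * ∑ (range 1 n) (λ k → u ^ k * (𝟙 (k <ᵇ f) * (𝟙 c * (+ 1) ^ f * z)))
indicator-geometric u false f z n _ =
  trans (vanish u ((+ 1) ^ f) (u ^ f) z)
  (sym (trans (cong ((+ 1 - u) *_) (∑-zero (range 1 n) (λ k → vanish′ (u ^ k) (𝟙 (k <ᵇ f)) ((+ 1) ^ f) z)))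
              (ℤP.*-zeroʳ (+ 1 - u))))
  where
  vanish : ∀ u a b z → u * (+ 0 * a * z) - + 0 * b * z ≡ + 0
  vanish = solve-∀
  vanish′ : ∀ a b c z → a * (b * (+ 0 * c * z)) ≡ + 0
  vanish′ = solve-∀
indicator-geometric u true f z n bounds with bounds refl
... | 1≤f , f≤1+n rewrite ℤP.^-zeroˡ f = sym (begin
  (+ 1 - u) * ∑ (range 1 n) (λ k → u ^ k * (𝟙 (k <ᵇ f) * (+ 1 * + 1 * z)))
    ≡⟨ cong ((+ 1 - u) *_) (trans (∑-cong (range 1 n) (λ k → reorder (u ^ k) (𝟙 (k <ᵇ f)) z))
                                  (∑-*ˡ (range 1 n) z (λ k → u ^ k * 𝟙 (k <ᵇ f)))) ⟩
  (+ 1 - u) * (z * ∑ (range 1 n) (λ k → u ^ k * 𝟙 (k <ᵇ f)))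
    ≡⟨ pull-out u z _ ⟩
  z * ((+ 1 - u) * ∑ (range 1 n) (λ k → u ^ k * 𝟙 (k <ᵇ f)))
    ≡⟨ cong (z *_) (geometric-sum u 1 n f 1≤f f≤1+n) ⟩
  z * (u ^ 1 - u ^ f)
    ≡⟨ tidy u (u ^ f) z ⟩
  u * (+ 1 * + 1 * z) - + 1 * u ^ f * z ∎)
  where
  reorder : ∀ a b z → a * (b * (+ 1 * + 1 * z)) ≡ z * (a * b)
  reorder = solve-∀
  pull-out : ∀ u z S → (+ 1 - u) * (z * S) ≡ z * ((+ 1 - u) * S)
  pull-out = solve-∀
  tidy : ∀ u p z → z * (u * + 1 - p) ≡ u * (+ 1 * + 1 * z) - + 1 * p * z
  tidy = solve-∀

ΔB-spec : ∀ m n u v → 1 ≤ m → (+ 1 - u) * ΔB m (suc n) u v ≡ u * B (suc n) m (+ 1) v - B (suc n) m u v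
ΔB-spec m n u v 1≤m = sym (begin
  u * B (suc n) m (+ 1) v - B (suc n) m u v
    ≡⟨ cong₂ (λ x y → u * x - y) (B≡∑weight-wide (suc n) m (+ 1) v 1≤m) (B≡∑weight-wide (suc n) m u v 1≤m) ⟩
  u * ∑ (lists (suc n) (suc (suc n))) (weight m (+ 1) v) - ∑ (lists (suc n) (suc (suc n))) (weight m u v)
    ≡⟨ ∑-linear-sub (lists (suc n) (suc (suc n))) u (weight m (+ 1) v) (weight m u v) ⟩
  ∑ (lists (suc n) (suc (suc n))) (λ σ → u * weight m (+ 1) v σ - weight m u v σ)
    ≡⟨ ∑-lists-cong (suc n) (suc (suc n)) (λ σ len →
         indicator-geometric u (admissible m σ) (fwd σ) (v ^ zeros σ) n (fwd-bounds σ len)) ⟩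
  ∑ (lists (suc n) (suc (suc n))) (λ σ → (+ 1 - u) * ∑ (range 1 n) (λ k → u ^ k * (𝟙 (k <ᵇ fwd σ) * weight m (+ 1) v σ)))
    ≡⟨ ∑-*ˡ (lists (suc n) (suc (suc n))) (+ 1 - u) _ ⟩
  (+ 1 - u) * ΔB m (suc n) u v ∎)
  where
  fwd-bounds : ∀ σ → length σ ≡ suc n → admissible m σ ≡ true → 1 ≤ fwd σ × fwd σ ≤ suc n
  fwd-bounds (x ∷ σ) len _ = fwd-positive x σ , subst (fwd (x ∷ σ) ≤_) len (fwd≤length (x ∷ σ))

-- The recurrences

B-decomposition : ∀ m n u v →
  B (suc (suc n)) (suc m) u v
  ≡ v * ∑ (lists (suc n) (suc n)) (endFreeWeight m u) + (v * B (suc n) (suc m) u v + v * ΔB m (suc n) u v)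
B-decomposition m n u v = begin
  B (suc (suc n)) (suc m) u v
    ≡⟨ B≡∑weight (suc (suc n)) (suc m) u v (s≤s z≤n) ⟩
  ∑ (lists (suc (suc n)) N) W
    ≡⟨ ∑-lists-head0 (suc n) (suc n) W (weight-suc∷ (suc m) u v) ⟩
  ∑ (lists (suc n) N) (λ σ → W (0 ∷ σ))
    ≡⟨ ∑-cong (lists (suc n) N) (λ σ → 𝟙-split (zeroFree σ) (W (0 ∷ σ))) ⟩
  ∑ (lists (suc n) N) (λ σ → 𝟙 (zeroFree σ) * W (0 ∷ σ) + 𝟙 (not (zeroFree σ)) * W (0 ∷ σ))
    ≡⟨ ∑-+ (lists (suc n) N) _ _ ⟩
  ∑ (lists (suc n) N) (λ σ → 𝟙 (zeroFree σ) * W (0 ∷ σ))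
    + ∑ (lists (suc n) N) (λ σ → 𝟙 (not (zeroFree σ)) * W (0 ∷ σ))
    ≡⟨ cong₂ _+_ zero-free (∑-with-second-zero m n u v) ⟩
  v * ∑ (lists (suc n) (suc n)) (endFreeWeight m u) + (v * ∑ (lists (suc n) N) W + v * ΔB m (suc n) u v)
    ≡⟨ cong (λ x → v * ∑ (lists (suc n) (suc n)) (endFreeWeight m u) + (v * x + v * ΔB m (suc n) u v))
            (sym (B≡∑weight-wide (suc n) (suc m) u v (s≤s z≤n))) ⟩
  v * ∑ (lists (suc n) (suc n)) (endFreeWeight m u) + (v * B (suc n) (suc m) u v + v * ΔB m (suc n) u v) ∎
  where
  N = suc (suc n)
  W = weight (suc m) u v
  zero-free : ∑ (lists (suc n) N) (λ σ → 𝟙 (zeroFree σ) * W (0 ∷ σ)) ≡ v * ∑ (lists (suc n) (suc n)) (endFreeWeight m u)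
  zero-free =
    trans (∑-lists-zeroFree (suc n) (suc n) (λ σ → W (0 ∷ σ)))
    (trans (∑-lists-cong (suc n) (suc n) (λ { (r ∷ ρ) _ → weight-0∷map-suc m u v r ρ }))
           (∑-*ˡ (lists (suc n) (suc n)) v (endFreeWeight m u)))

B-recurrence : (n m : ℕ) → 3 ≤ n → 2 ≤ m → m ≤ n ∸ 1 → (u v : ℤ) →
  (+ 1 - u) * B n m u v
  ≡ (+ 1 - u) * (v * B (n ∸ 1) m u v)
    + v * (u * B (n ∸ 1) (m ∸ 1) (+ 1) v - B (n ∸ 1) (m ∸ 1) u v)
    + (+ 1 - u) * (v * sumFrom 0 (n ∸ m) (λ j → (u ^ j) * B (n ∸ j ∸ 1) (m ∸ 1) u (+ 1)))
B-recurrence (suc (suc n)) (suc m) _ (s≤s 1≤m) (s≤s m≤n) u v = begin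
  (+ 1 - u) * B (suc (suc n)) (suc m) u v
    ≡⟨ cong ((+ 1 - u) *_) (B-decomposition m n u v) ⟩
  (+ 1 - u) * (v * S + (v * B (suc n) (suc m) u v + v * ΔB m (suc n) u v))
    ≡⟨ regroup u v S (B (suc n) (suc m) u v) (ΔB m (suc n) u v) ⟩
  (+ 1 - u) * (v * B (suc n) (suc m) u v) + v * ((+ 1 - u) * ΔB m (suc n) u v) + (+ 1 - u) * (v * S)
    ≡⟨ cong₂ (λ x y → (+ 1 - u) * (v * B (suc n) (suc m) u v) + v * x + (+ 1 - u) * (v * y))
             (ΔB-spec m n u v 1≤m) (∑-endFreeWeight m n u 1≤m m≤n) ⟩
  (+ 1 - u) * (v * B (suc n) (suc m) u v)
    + v * (u * B (suc n) m (+ 1) v - B (suc n) m u v)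
    + (+ 1 - u) * (v * sumFrom 0 (suc n ∸ m) (λ j → u ^ j * B (suc (suc n) ∸ j ∸ 1) m u (+ 1))) ∎
  where
  S = ∑ (lists (suc n) (suc n)) (endFreeWeight m u)
  regroup : ∀ u v S R D → (+ 1 - u) * (v * S + (v * R + v * D))
                          ≡ (+ 1 - u) * (v * R) + v * ((+ 1 - u) * D) + (+ 1 - u) * (v * S)
  regroup = solve-∀

endFreeWeight-no-ascents : ∀ u ρ → endFreeWeight 0 u ρ ≡ 𝟙 (allZero ρ) * u ^ length ρ
endFreeWeight-no-ascents u ρ with allZero ρ in all0
... | true  rewrite allZero⇒≡replicate ρ all0 =
  cong₂ (λ c f → 𝟙 c * u ^ f)
    (cong₂ _∧_ (isAscentSeq-++-zeros [] n) (cong₂ _∧_ (cong not (contains-++-zeros [] n)) (cong (_≡ᵇ 0) (asc-zeros n))))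
    (fwd-weaklyDecreasing (replicate n 0) (weaklyDecreasing-zeros n))
  where n = length ρ
... | false = trans (cong (λ c → 𝟙 c * u ^ fwd ρ) not-counted)
                    (trans (ℤP.*-zeroˡ (u ^ fwd ρ)) (sym (ℤP.*-zeroˡ (u ^ length ρ))))
  where
  not-counted : isAscentSeq ρ ∧ (avoids ρ pat0012 ∧ (asc ρ ≡ᵇ 0)) ≡ false
  not-counted with isAscentSeq ρ in a | asc ρ ≡ᵇ 0 in asc0
  ... | false | _     = refl
  ... | true  | false = BP.∧-zeroʳ _
  ... | true  | true  with trans (sym (no-ascents⇒allZero ρ a (≡ᵇ≡true⇒≡ (asc ρ) 0 asc0))) all0
  ...   | ()

weight-no-ascents : ∀ u v x σ → weight 0 u v (x ∷ σ) ≡ + 0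
weight-no-ascents u v (suc x) σ = weight-suc∷ 0 u v x σ
weight-no-ascents u v zero    σ = weight-≡0 0 u v (0 ∷ σ) not-counted
  where
  not-counted : admissible 0 (0 ∷ σ) ≡ false
  not-counted = by-ascents (asc (0 ∷ σ) ≡ᵇ 0) refl
    where
    by-ascents : ∀ c → (asc (0 ∷ σ) ≡ᵇ 0) ≡ c → admissible 0 (0 ∷ σ) ≡ false
    by-ascents false asc0 = admissible-asc 0 (0 ∷ σ) asc0
    by-ascents true  asc0 = admissible-endsInZero 0 (0 ∷ σ) (trans (endsInZero≡endsIn0 (0 ∷ σ))
                              (weaklyDecreasing⇒endsIn0 (0 ∷ σ) (asc≡0⇒weaklyDecreasing (0 ∷ σ) (≡ᵇ≡true⇒≡ _ 0 asc0)) refl))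

B-one-ascent-step : ∀ n u v → B (suc (suc n)) 1 u v ≡ v * u ^ suc n + v * B (suc n) 1 u v
B-one-ascent-step n u v = begin
  B (suc (suc n)) 1 u v
    ≡⟨ B-decomposition 0 n u v ⟩
  v * ∑ (lists (suc n) (suc n)) (endFreeWeight 0 u) + (v * B (suc n) 1 u v + v * ΔB 0 (suc n) u v)
    ≡⟨ cong₂ (λ x y → v * x + (v * B (suc n) 1 u v + v * y)) only-zeros no-ΔB ⟩
  v * u ^ suc n + (v * B (suc n) 1 u v + v * + 0)
    ≡⟨ cong (λ x → v * u ^ suc n + x) (trans (cong (_+_ (v * B (suc n) 1 u v)) (ℤP.*-zeroʳ v)) (ℤP.+-identityʳ _)) ⟩
  v * u ^ suc n + v * B (suc n) 1 u v ∎
  where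
  only-zeros : ∑ (lists (suc n) (suc n)) (endFreeWeight 0 u) ≡ u ^ suc n
  only-zeros = trans (∑-lists-cong (suc n) (suc n) (λ ρ len → trans (endFreeWeight-no-ascents u ρ)
                                                                     (cong (λ k → 𝟙 (allZero ρ) * u ^ k) len)))
                     (∑-lists-allZero (suc n) n (λ _ → u ^ suc n))
  no-ΔB : ΔB 0 (suc n) u v ≡ + 0
  no-ΔB = trans (∑-lists-cong (suc n) (suc (suc n)) (λ { (x ∷ σ) _ → ∑-zero (range 1 n) (λ k →
            trans (cong (λ w → u ^ k * (𝟙 (k <ᵇ fwd (x ∷ σ)) * w)) (weight-no-ascents (+ 1) v x σ))
                  (solve-zero (u ^ k) (𝟙 (k <ᵇ fwd (x ∷ σ))))) }))
          (∑-zero (lists (suc n) (suc (suc n))) (λ _ → refl))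
    where
    solve-zero : ∀ a b → a * (b * + 0) ≡ + 0
    solve-zero = solve-∀

B-one-ascent-closed : ∀ n u v → (u - v) * B (suc (suc n)) 1 u v ≡ u * v * (u ^ suc n - v ^ suc n)
B-one-ascent-closed zero    u v = begin
  (u - v) * B 2 1 u v
    ≡⟨ cong ((u - v) *_) (trans (B-one-ascent-step 0 u v)
                                (cong (λ z → v * u ^ 1 + v * z) (B-short 1 1 u v (s≤s z≤n) (s≤s z≤n)))) ⟩
  (u - v) * (v * (u * + 1) + v * + 0)
    ≡⟨ base u v ⟩
  u * v * (u * + 1 - v * + 1) ∎
  where
  base : ∀ u v → (u - v) * (v * (u * + 1) + v * + 0) ≡ u * v * (u * + 1 - v * + 1)
  base = solve-∀
B-one-ascent-closed (suc n) u v = begin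
  (u - v) * B (suc (suc (suc n))) 1 u v
    ≡⟨ cong ((u - v) *_) (B-one-ascent-step (suc n) u v) ⟩
  (u - v) * (v * (u * u ^ suc n) + v * B (suc (suc n)) 1 u v)
    ≡⟨ distrib u v (u ^ suc n) (B (suc (suc n)) 1 u v) ⟩
  v * (u * u ^ suc n) * (u - v) + v * ((u - v) * B (suc (suc n)) 1 u v)
    ≡⟨ cong (λ z → v * (u * u ^ suc n) * (u - v) + v * z) (B-one-ascent-closed n u v) ⟩
  v * (u * u ^ suc n) * (u - v) + v * (u * v * (u ^ suc n - v ^ suc n))
    ≡⟨ collect u v (u ^ suc n) (v ^ suc n) ⟩
  u * v * (u * u ^ suc n - v * v ^ suc n) ∎
  where
  distrib : ∀ u v p b → (u - v) * (v * (u * p) + v * b) ≡ v * (u * p) * (u - v) + v * ((u - v) * b)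
  distrib = solve-∀
  collect : ∀ u v p q → v * (u * p) * (u - v) + v * (u * v * (p - q)) ≡ u * v * (u * p - v * q)
  collect = solve-∀

B-one-ascent : (n : ℕ) → 3 ≤ n → (u v : ℤ) → (u - v) * B n 1 u v ≡ u * v * (u ^ (n ∸ 1) - v ^ (n ∸ 1))
B-one-ascent (suc (suc n)) _          = B-one-ascent-closed n
B-one-ascent (suc zero)    (s≤s ())

lemma2 : ((n m : ℕ) → 3 ≤ n → 2 ≤ m → m ≤ n ∸ 1 → (u v : ℤ) →
             (+ 1 - u) * B n m u v
               ≡ (+ 1 - u) * (v * B (n ∸ 1) m u v)
                 + v * (u * B (n ∸ 1) (m ∸ 1) (+ 1) v - B (n ∸ 1) (m ∸ 1) u v)
                 + (+ 1 - u) * (v * sumFrom 0 (n ∸ m) (λ j → (u ^ j) * B (n ∸ j ∸ 1) (m ∸ 1) u (+ 1))))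
         × ((n : ℕ) → 3 ≤ n → (u v : ℤ) →
             (u - v) * B n 1 u v ≡ u * v * (u ^ (n ∸ 1) - v ^ (n ∸ 1)))
lemma2 = B-recurrence , B-one-ascent
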